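{- Let $p$ be a prime, $n\in\mathbb Z^+$, and $s,t\in\{0,\ldots,p-1\}$ with $s\neq p-1$. If $s<t$ then $$\left\{\begin{matrix} pn+s\\ t\end{matrix}\right\}_{n-1,p}\equiv(-1)^{n+s}\frac n{t\binom{t-1}s}\pmod p .$$ If $s\geqslant t$, then $$\sigma_{st}:=1+(-1)^p\frac{\prod_{1\leqslant i\leqslant p,\, i\neq p-t}(p(n-1)+t+i)}{\prod_{1\leqslant i\leqslant p,\, i\neq p-(s-t)}(s-t+i)}\equiv1+(-1)^p\equiv0\pmod p,$$ and $$\left\{\begin{matrix} pn+s\\ t\end{matrix}\right\}_{n-1,p}\equiv(-1)^{n+t}\,n\binom st\frac{\sigma_{st}}p\pmod p .$$
   Context: Binomial coefficients: $\binom x0=1$, $\binom xk=x(x-1)\cdots(x-k+1)/k!$ for $k\in\mathbb Z^+$ (for rational $x$), and $\binom xk=0$ for negative integers $k$. For a prime $p$, $l,N\in\mathbb N=\{0,1,\ldots\}$ and $r\in\mathbb Z$, $$\left\{\begin{matrix} N\\ r\end{matrix}\right\}_{l,p}:=p^{ -\left\lfloor\frac{N-1-lp}{p-1}\right\rfloor}\sum_{k\equiv r\,(\mathrm{mod}\ p)}(-1)^k\binom Nk\binom{(k-r)/p}l,$$ the sum over all integers $k\equiv r\pmod p$. Congruences modulo $p$ between rational numbers mean the difference is $p$ times a rational number with denominator prime to $p$. -}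

module Defs where

open import Data.Nat as ℕ using (ℕ; zero; suc; _≡ᵇ_)
open import Data.Nat.Combinatorics using (_C_)
open import Data.Nat.Coprimality using (Coprime)
open import Data.Integer as ℤ using (ℤ; +_; -[1+_])
open import Data.Integer.Divisibility.Signed using (_∣?_)
open import Data.Rational as ℚ using (ℚ; 0ℚ; 1ℚ; _+_; _*_; _-_; -_; ↧ₙ_; floor; _÷_; ≢-nonZero)
open import Data.Rational.Properties using (_≟_)
open import Data.Bool using (if_then_else_)
open import Data.Product using (∃; _×_)
open import Relation.Nullary using (yes; no)
open import Relation.Binary.PropositionalEquality using (_≡_)

ℤtoℚ : ℤ → ℚ
ℤtoℚ z = z ℚ./ 1

ℕtoℚ : ℕ → ℚ
ℕtoℚ n = ℤtoℚ (+ n)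

-- total division on ℚ (x // 0 = 0); only ever applied to nonzero divisors below
infixl 7 _//_
_//_ : ℚ → ℚ → ℚ
x // y with y ≟ 0ℚ
... | yes _ = 0ℚ
... | no y≢0 = _÷_ x y {{≢-nonZero y≢0}}

infixr 8 _^ℕ_ _^ℤ_
_^ℕ_ : ℚ → ℕ → ℚ
x ^ℕ zero = 1ℚ
x ^ℕ suc n = x * x ^ℕ n

_^ℤ_ : ℚ → ℤ → ℚ
x ^ℤ (+ n) = x ^ℕ n
x ^ℤ -[1+ n ] = 1ℚ // (x ^ℕ suc n)

sgn : ℕ → ℚ
sgn m = (- 1ℚ) ^ℕ m

binomQ : ℚ → ℕ → ℚ
binomQ x zero = 1ℚ
binomQ x (suc k) = binomQ x k * (x - ℕtoℚ k) // ℕtoℚ (suc k)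

sumTo : ℕ → (ℕ → ℚ) → ℚ
sumTo zero f = f 0
sumTo (suc N) f = sumTo N f + f (suc N)

prodFrom1 : ℕ → (ℕ → ℚ) → ℚ
prodFrom1 zero f = 1ℚ
prodFrom1 (suc m) f = prodFrom1 m f * f (suc m)

prodExcept : ℕ → ℕ → (ℕ → ℚ) → ℚ
prodExcept m j f = prodFrom1 m (λ i → if i ≡ᵇ j then 1ℚ else f i)

-- the summand of the bracket for an integer index k ≥ 0 (the binomial
-- coefficient (N choose k) vanishes for k < 0 and k > N, so only 0 ≤ k ≤ N matter)
braceTerm : ℕ → ℤ → ℕ → ℕ → ℕ → ℚ
braceTerm N r l p k with (+ p) ∣? (+ k ℤ.- r)
... | yes _ = sgn k * ℕtoℚ (N C k) * binomQ (ℤtoℚ (+ k ℤ.- r) // ℕtoℚ p) l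
... | no _ = 0ℚ

braceExp : ℕ → ℕ → ℕ → ℤ
braceExp N l p = floor ((ℕtoℚ N - 1ℚ - ℕtoℚ l * ℕtoℚ p) // (ℕtoℚ p - 1ℚ))

brace : ℕ → ℤ → ℕ → ℕ → ℚ
brace N r l p = ℕtoℚ p ^ℤ (ℤ.- braceExp N l p) * sumTo N (braceTerm N r l p)

CongQ : ℕ → ℚ → ℚ → Set
CongQ p x y = ∃ λ q → (x - y ≡ ℕtoℚ p * q) × Coprime (↧ₙ q) p

σ : ℕ → ℕ → ℕ → ℕ → ℚ
σ p n s t = 1ℚ + sgn p *
  (prodExcept p (p ℕ.∸ t) (λ i → ℕtoℚ (p ℕ.* (n ℕ.∸ 1) ℕ.+ t ℕ.+ i))
   // prodExcept p (p ℕ.∸ (s ℕ.∸ t)) (λ i → ℕtoℚ (s ℕ.∸ t ℕ.+ i)))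

module Submission where

-- With N = pn + s and l = n - 1 the exponent of p in the bracket is 1 (this uses s ≤ p - 2),
-- and of the terms k ≡ t (mod p) only k = K := p(n - 1) + t survives, together with
-- k = K + p when t ≤ s: for smaller k the binomial ((k - t)/p choose n - 1) vanishes, and
-- larger k exceed N.  Each surviving binomial coefficient is a quotient of falling factorials,
-- and modulo p a run of consecutive integers is a product of factorials of residues, so
-- everything reduces to (p - 1)! ≡ (-1)^u u! (p - 1 - u)!.  When t ≤ s the two terms combine
-- exactly into (-1)^(K+p) n (N choose K + p) σ/p, because (N choose K)/(N choose K + p) is n
-- times the ratio of the two punctured products in σ; both products are ≡ (p - 1)!, whence
-- σ ≡ 1 + (-1)^p ≡ 0, and (N choose K + p) ≡ (s choose t).  Congruences between rationals
-- are obtained from congruences between integers by clearing denominators prime to p.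

module IntegerCongruence where

  open import Data.Nat as ℕ using (ℕ; zero; suc; _!)
  import Data.Nat.Properties as ℕ
  import Data.Nat.Divisibility as ℕ
  open import Data.Nat.Primality using (Prime; euclidsLemma; prime⇒irreducible; prime⇒nonTrivial)
  open import Data.Integer hiding (_≤_; _<_; suc)
  open import Data.Integer.Properties using (abs-*; pos-*; +-inverseʳ; ^-*-assoc)
  open import Data.Integer.Divisibility.Signed
  open import Data.Integer.Tactic.RingSolver using (solve-∀)
  open import Data.Empty using (⊥-elim)
  open import Data.Product using (_×_; _,_)
  open import Data.Sum using (_⊎_; inj₁; inj₂)
  open import Relation.Nullary using (¬_)
  open import Level using (0ℓ)
  open import Relation.Binary.Bundles using (Setoid)
  open import Relation.Binary.PropositionalEquality

  infix 4 _≡_[mod_]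
  record _≡_[mod_] (a b : ℤ) (m : ℕ) : Set where
    constructor mod-intro
    field divides-difference : + m ∣ a - b
  open _≡_[mod_] public

  module _ {m : ℕ} where

    mod-refl : ∀ {a} → a ≡ a [mod m ]
    mod-refl {a} = mod-intro (subst (+ m ∣_) (sym (+-inverseʳ a)) (divides (+ 0) refl))

    mod-reflexive : ∀ {a b} → a ≡ b → a ≡ b [mod m ]
    mod-reflexive refl = mod-refl

    mod-sym : ∀ {a b} → a ≡ b [mod m ] → b ≡ a [mod m ]
    mod-sym {a} {b} (mod-intro d) = mod-intro (subst (+ m ∣_) (e a b) (∣m⇒∣-m d))
      where e : ∀ a b → - (a - b) ≡ b - a
            e = solve-∀

    mod-trans : ∀ {a b c} → a ≡ b [mod m ] → b ≡ c [mod m ] → a ≡ c [mod m ]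
    mod-trans {a} {b} {c} (mod-intro d₁) (mod-intro d₂) =
      mod-intro (subst (+ m ∣_) (e a b c) (∣m∣n⇒∣m+n d₁ d₂))
      where e : ∀ a b c → (a - b) + (b - c) ≡ a - c
            e = solve-∀

    mod-setoid : Setoid 0ℓ 0ℓ
    mod-setoid = record
      { Carrier = ℤ
      ; _≈_ = _≡_[mod m ]
      ; isEquivalence = record { refl = mod-refl ; sym = mod-sym ; trans = mod-trans }
      }

    mod-+-cong : ∀ {a b c d} → a ≡ b [mod m ] → c ≡ d [mod m ] → a + c ≡ b + d [mod m ]
    mod-+-cong {a} {b} {c} {d} (mod-intro d₁) (mod-intro d₂) =
      mod-intro (subst (+ m ∣_) (e a b c d) (∣m∣n⇒∣m+n d₁ d₂))
      where e : ∀ a b c d → (a - b) + (c - d) ≡ (a + c) - (b + d)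
            e = solve-∀

    mod-*-cong : ∀ {a b c d} → a ≡ b [mod m ] → c ≡ d [mod m ] → a * c ≡ b * d [mod m ]
    mod-*-cong {a} {b} {c} {d} (mod-intro d₁) (mod-intro d₂) =
      mod-intro (subst (+ m ∣_) (e a b c d) (∣m∣n⇒∣m+n (∣m⇒∣m*n c d₁) (∣n⇒∣m*n b d₂)))
      where e : ∀ a b c d → (a - b) * c + b * (c - d) ≡ a * c - b * d
            e = solve-∀

    mod-*-congˡ : ∀ c {a b} → a ≡ b [mod m ] → c * a ≡ c * b [mod m ]
    mod-*-congˡ c = mod-*-cong (mod-refl {c})

    mod-*-congʳ : ∀ c {a b} → a ≡ b [mod m ] → a * c ≡ b * c [mod m ]
    mod-*-congʳ c a≡b = mod-*-cong a≡b (mod-refl {c})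

    mod-^-cong : ∀ {a b} n → a ≡ b [mod m ] → a ^ n ≡ b ^ n [mod m ]
    mod-^-cong zero    a≡b = mod-refl
    mod-^-cong (suc n) a≡b = mod-*-cong a≡b (mod-^-cong n a≡b)

    multiple+a≡a : ∀ k a → + m * k + a ≡ a [mod m ]
    multiple+a≡a k a = mod-intro (divides k (e (+ m) k a))
      where e : ∀ x k a → x * k + a - a ≡ k * x
            e = solve-∀

  ∤⇒≢0 : ∀ {m x} → ¬ (+ m ∣ x) → x ≢ 0ℤ
  ∤⇒≢0 m∤x refl = m∤x (divides 0ℤ refl)

  module ≡-mod-Reasoning (m : ℕ) where
    open import Relation.Binary.Reasoning.Setoid (mod-setoid {m}) public

  -1^n-parity : ∀ n → (-1ℤ ^ n ≡ 1ℤ × 2 ℕ.∣ n) ⊎ (-1ℤ ^ n ≡ -1ℤ × 2 ℕ.∣ suc n)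
  -1^n-parity zero = inj₁ (refl , 2 ℕ.∣0)
  -1^n-parity (suc n) with -1^n-parity n
  ... | inj₁ (e , 2∣n) = inj₂ (cong (-1ℤ *_) e , ℕ.∣m∣n⇒∣m+n (ℕ.divides 1 refl) 2∣n)
  ... | inj₂ (e , 2∣1+n) = inj₁ (cong (-1ℤ *_) e , 2∣1+n)

  -1^n*-1^n≡1 : ∀ n → -1ℤ ^ n * -1ℤ ^ n ≡ 1ℤ
  -1^n*-1^n≡1 zero    = refl
  -1^n*-1^n≡1 (suc n) = trans (e (-1ℤ ^ n)) (-1^n*-1^n≡1 n)
    where e : ∀ x → (-1ℤ * x) * (-1ℤ * x) ≡ x * x
          e = solve-∀

  module _ {p : ℕ} (p-prime : Prime p) where

    prime∤1 : ¬ (+ p ∣ 1ℤ)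
    prime∤1 p∣1 with ℕ.∣1⇒≡1 (∣⇒∣ᵤ p∣1)
    ... | refl = ⊥-elim (ℕ.<-irrefl refl (ℕ.nonTrivial⇒n>1 1 ⦃ prime⇒nonTrivial p-prime ⦄))

    prime∣*⇒∣⊎∣ : ∀ a b → + p ∣ a * b → (+ p ∣ a) ⊎ (+ p ∣ b)
    prime∣*⇒∣⊎∣ a b p∣ab with euclidsLemma ∣ a ∣ ∣ b ∣ p-prime (subst (p ℕ.∣_) (abs-* a b) (∣⇒∣ᵤ p∣ab))
    ... | inj₁ p∣a = inj₁ (∣ᵤ⇒∣ p∣a)
    ... | inj₂ p∣b = inj₂ (∣ᵤ⇒∣ p∣b)

    prime∤* : ∀ {a b} → ¬ (+ p ∣ a) → ¬ (+ p ∣ b) → ¬ (+ p ∣ a * b)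
    prime∤* {a} {b} p∤a p∤b p∣ab with prime∣*⇒∣⊎∣ a b p∣ab
    ... | inj₁ p∣a = p∤a p∣a
    ... | inj₂ p∣b = p∤b p∣b

    prime∤! : ∀ c → c ℕ.< p → ¬ (+ p ∣ + (c !))
    prime∤! zero    _   = prime∤1
    prime∤! (suc c) c<p p∣c! with prime∣*⇒∣⊎∣ (+ suc c) (+ (c !)) (subst (+ p ∣_) (pos-* (suc c) (c !)) p∣c!)
    ... | inj₁ p∣1+c = ℕ.<⇒≱ c<p (ℕ.∣⇒≤ (∣⇒∣ᵤ p∣1+c))
    ... | inj₂ p∣c!  = prime∤! c (ℕ.<-trans (ℕ.n<1+n c) c<p) p∣c!

    ∤-resp-≡[mod] : ∀ {x y} → ¬ (+ p ∣ x) → x ≡ y [mod p ] → ¬ (+ p ∣ y)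
    ∤-resp-≡[mod] {x} {y} p∤x (mod-intro d) p∣y = p∤x (subst (+ p ∣_) (e x y) (∣m∣n⇒∣m+n d p∣y))
      where e : ∀ x y → x - y + y ≡ x
            e = solve-∀

    mod-*-cancelˡ : ∀ c {a b} → ¬ (+ p ∣ c) → c * a ≡ c * b [mod p ] → a ≡ b [mod p ]
    mod-*-cancelˡ c {a} {b} p∤c (mod-intro d) with prime∣*⇒∣⊎∣ c (a - b) (subst (+ p ∣_) (e c a b) d)
      where e : ∀ c a b → c * a - c * b ≡ c * (a - b)
            e = solve-∀
    ... | inj₁ p∣c   = ⊥-elim (p∤c p∣c)
    ... | inj₂ p∣a-b = mod-intro p∣a-b

    -1^p≡-1 : -1ℤ ^ p ≡ -1ℤ [mod p ]
    -1^p≡-1 with -1^n-parity p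
    ... | inj₂ (-1^p≡-1 , _) = mod-reflexive -1^p≡-1
    ... | inj₁ (_ , 2∣p) with prime⇒irreducible p-prime 2∣p
    ...   | inj₁ ()
    ...   | inj₂ refl = mod-intro (divides 1ℤ refl)

    -1^[p*n]≡-1^n : ∀ n → -1ℤ ^ (p ℕ.* n) ≡ -1ℤ ^ n [mod p ]
    -1^[p*n]≡-1^n n = mod-trans (mod-reflexive (sym (^-*-assoc -1ℤ p n))) (mod-^-cong n -1^p≡-1)

    1+-1^p≡0 : 1ℤ + -1ℤ ^ p ≡ 0ℤ [mod p ]
    1+-1^p≡0 = mod-+-cong (mod-refl {a = 1ℤ}) -1^p≡-1

module FallingFactorial where

  open import Data.Nat as ℕ using (ℕ; zero; suc; _!)
  import Data.Nat.Properties as ℕ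
  import Data.Nat.Divisibility as ℕ
  open import Data.Integer hiding (suc; _≤_; _<_)
  open import Data.Integer.Properties
    using (+-identityʳ; *-identityˡ; *-identityʳ; *-assoc; pos-+; pos-*; neg-minus-pos)
  open import Data.Integer.Divisibility.Signed using (divides)
  open import Data.Integer.Tactic.RingSolver using (solve-∀)
  open import Relation.Binary.PropositionalEquality
  open IntegerCongruence

  infixl 7.5 _↓_
  _↓_ : ℤ → ℕ → ℤ
  x ↓ zero  = 1ℤ
  x ↓ suc c = x * (x - 1ℤ) ↓ c

  ↓-+ : ∀ x a b → x ↓ (a ℕ.+ b) ≡ x ↓ a * (x - + a) ↓ b
  ↓-+ x zero    b = trans (cong (_↓ b) (sym (+-identityʳ x))) (sym (*-identityˡ _))
  ↓-+ x (suc a) b = begin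
    x * (x - 1ℤ) ↓ (a ℕ.+ b)                 ≡⟨ cong (x *_) (↓-+ (x - 1ℤ) a b) ⟩
    x * ((x - 1ℤ) ↓ a * (x - 1ℤ - + a) ↓ b)  ≡⟨ cong (λ y → x * ((x - 1ℤ) ↓ a * y ↓ b)) (e x (+ a)) ⟩
    x * ((x - 1ℤ) ↓ a * (x - + suc a) ↓ b)   ≡⟨ *-assoc x ((x - 1ℤ) ↓ a) ((x - + suc a) ↓ b) ⟨
    x * (x - 1ℤ) ↓ a * (x - + suc a) ↓ b     ∎
    where
    open ≡-Reasoning
    e : ∀ x a → x - 1ℤ - a ≡ x - (1ℤ + a)
    e = solve-∀

  ↓-cong : ∀ {m x y} c → x ≡ y [mod m ] → x ↓ c ≡ y ↓ c [mod m ]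
  ↓-cong zero    x≡y = mod-refl
  ↓-cong (suc c) x≡y = mod-*-cong x≡y (↓-cong c (mod-+-cong x≡y mod-refl))

  1+n-1≡n : ∀ n → + suc n - 1ℤ ≡ + n
  1+n-1≡n n = e (+ n)
    where e : ∀ x → 1ℤ + x - 1ℤ ≡ x
          e = solve-∀

  +[m+1+n]-1≡+[m+n] : ∀ m n → + (m ℕ.+ suc n) - 1ℤ ≡ + (m ℕ.+ n)
  +[m+1+n]-1≡+[m+n] m n = trans (cong (λ k → + k - 1ℤ) (ℕ.+-suc m n)) (1+n-1≡n (m ℕ.+ n))

  +[m+n]-+n≡+m : ∀ m n → + (m ℕ.+ n) - + n ≡ + m
  +[m+n]-+n≡+m m n = trans (cong (_- + n) (pos-+ m n)) (e (+ m) (+ n))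
    where e : ∀ x y → x + y - y ≡ x
          e = solve-∀

  +[m+n]-+m≡+n : ∀ m n → + (m ℕ.+ n) - + m ≡ + n
  +[m+n]-+m≡+n m n = trans (cong (λ k → + k - + m) (ℕ.+-comm m n)) (+[m+n]-+n≡+m n m)

  [m+c]!≡[m+c]↓c*m! : ∀ m c → + ((m ℕ.+ c) !) ≡ + (m ℕ.+ c) ↓ c * + (m !)
  [m+c]!≡[m+c]↓c*m! m zero = trans (cong (λ k → + (k !)) (ℕ.+-identityʳ m)) (sym (*-identityˡ _))
  [m+c]!≡[m+c]↓c*m! m (suc c) rewrite ℕ.+-suc m c = begin
    + (suc (m ℕ.+ c) ℕ.* (m ℕ.+ c) !)                   ≡⟨ pos-* (suc (m ℕ.+ c)) _ ⟩
    + suc (m ℕ.+ c) * + ((m ℕ.+ c) !)                   ≡⟨ cong (+ suc (m ℕ.+ c) *_) ([m+c]!≡[m+c]↓c*m! m c) ⟩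
    + suc (m ℕ.+ c) * (+ (m ℕ.+ c) ↓ c * + (m !))       ≡⟨ *-assoc (+ suc (m ℕ.+ c)) (+ (m ℕ.+ c) ↓ c) (+ (m !)) ⟨
    + suc (m ℕ.+ c) * + (m ℕ.+ c) ↓ c * + (m !)         ≡⟨ cong (λ y → + suc (m ℕ.+ c) * y ↓ c * + (m !)) (1+n-1≡n (m ℕ.+ c)) ⟨
    + suc (m ℕ.+ c) * (+ suc (m ℕ.+ c) - 1ℤ) ↓ c * + (m !) ∎
    where open ≡-Reasoning

  n↓n≡n! : ∀ n → + n ↓ n ≡ + (n !)
  n↓n≡n! n = sym (trans ([m+c]!≡[m+c]↓c*m! 0 n) (*-identityʳ _))

  -[1+a]↓c*a!≡±[a+c]! : ∀ a c → -[1+ a ] ↓ c * + (a !) ≡ -1ℤ ^ c * + ((a ℕ.+ c) !)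
  -[1+a]↓c*a!≡±[a+c]! a zero = trans (*-identityˡ _) (trans (cong (λ k → + (k !)) (sym (ℕ.+-identityʳ a))) (sym (*-identityˡ _)))
  -[1+a]↓c*a!≡±[a+c]! a (suc c) = begin
    -[1+ a ] * (-[1+ a ] - 1ℤ) ↓ c * + (a !)             ≡⟨ cong (λ y → -[1+ a ] * y ↓ c * + (a !)) (neg-minus-pos a 1) ⟩
    -[1+ a ] * -[1+ suc a ] ↓ c * + (a !)                 ≡⟨ e (-[1+ suc a ] ↓ c) (+ (a !)) (+ a) ⟩
    -1ℤ * (-[1+ suc a ] ↓ c * (+ suc a * + (a !)))        ≡⟨ cong (λ y → -1ℤ * (-[1+ suc a ] ↓ c * y)) (pos-* (suc a) (a !)) ⟨
    -1ℤ * (-[1+ suc a ] ↓ c * + (suc a !))                ≡⟨ cong (-1ℤ *_) (-[1+a]↓c*a!≡±[a+c]! (suc a) c) ⟩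
    -1ℤ * (-1ℤ ^ c * + ((suc a ℕ.+ c) !))                 ≡⟨ *-assoc -1ℤ (-1ℤ ^ c) (+ ((suc a ℕ.+ c) !)) ⟨
    -1ℤ ^ suc c * + ((suc a ℕ.+ c) !)                     ≡⟨ cong (λ k → -1ℤ ^ suc c * + (k !)) (ℕ.+-suc a c) ⟨
    -1ℤ ^ suc c * + ((a ℕ.+ suc c) !)                     ∎
    where
    open ≡-Reasoning
    e : ∀ d f g → - (1ℤ + g) * d * f ≡ -1ℤ * (d * ((1ℤ + g) * f))
    e = solve-∀

  -1↓c≡±c! : ∀ c → -1ℤ ↓ c ≡ -1ℤ ^ c * + (c !)
  -1↓c≡±c! c = trans (sym (*-identityʳ _)) (-[1+a]↓c*a!≡±[a+c]! 0 c)

  wilson-split : ∀ {p} a u → a ℕ.+ u ℕ.+ 1 ≡ p → + ((a ℕ.+ u) !) ≡ -1ℤ ^ u * + (u !) * + (a !) [mod p ]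
  wilson-split {p} a u a+u+1≡p = begin
    + ((a ℕ.+ u) !)                 ≡⟨ [m+c]!≡[m+c]↓c*m! a u ⟩
    + (a ℕ.+ u) ↓ u * + (a !)       ≈⟨ mod-*-congʳ (+ (a !)) (↓-cong u a+u≡-1) ⟩
    -1ℤ ↓ u * + (a !)               ≡⟨ cong (_* + (a !)) (-1↓c≡±c! u) ⟩
    -1ℤ ^ u * + (u !) * + (a !)     ∎
    where
    open ≡-mod-Reasoning p
    a+u≡-1 : + (a ℕ.+ u) ≡ -1ℤ [mod p ]
    a+u≡-1 = mod-intro (divides 1ℤ (trans (cong +_ a+u+1≡p) (sym (*-identityˡ (+ p)))))

  -- (c + 1)(c + 2)⋯(c + j + 1 + a) with the factor c + j + 1 left out: the shape of both
  -- products in σ.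
  punctured : ℕ → ℕ → ℕ → ℤ
  punctured c j a = + (c ℕ.+ j) ↓ j * + (c ℕ.+ suc (j ℕ.+ a)) ↓ a

  block≡punctured*omitted : ∀ c j a →
    + (c ℕ.+ suc (j ℕ.+ a)) ↓ suc (j ℕ.+ a) ≡ punctured c j a * + (c ℕ.+ suc j)
  block≡punctured*omitted c j a = begin
    x ↓ suc (j ℕ.+ a)                               ≡⟨ cong (x ↓_) (trans (cong suc (ℕ.+-comm j a)) (sym (ℕ.+-suc a j))) ⟩
    x ↓ (a ℕ.+ suc j)                               ≡⟨ ↓-+ x a (suc j) ⟩
    x ↓ a * (x - + a) ↓ suc j                       ≡⟨ cong (λ y → x ↓ a * y ↓ suc j) x-a≡omitted ⟩
    x ↓ a * (+ (c ℕ.+ suc j) * (+ (c ℕ.+ suc j) - 1ℤ) ↓ j)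
                                                    ≡⟨ cong (λ y → x ↓ a * (+ (c ℕ.+ suc j) * y ↓ j)) (+[m+1+n]-1≡+[m+n] c j) ⟩
    x ↓ a * (+ (c ℕ.+ suc j) * + (c ℕ.+ j) ↓ j)     ≡⟨ e (x ↓ a) (+ (c ℕ.+ suc j)) (+ (c ℕ.+ j) ↓ j) ⟩
    punctured c j a * + (c ℕ.+ suc j)               ∎
    where
    open ≡-Reasoning
    x : ℤ
    x = + (c ℕ.+ suc (j ℕ.+ a))
    x-a≡omitted : x - + a ≡ + (c ℕ.+ suc j)
    x-a≡omitted = trans (cong (λ n → + n - + a) (sym (ℕ.+-assoc c (suc j) a))) (+[m+n]-+n≡+m (c ℕ.+ suc j) a)
    e : ∀ u v w → u * (v * w) ≡ w * u * v
    e = solve-∀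

  punctured≡[p-1]! : ∀ {p} c j a → p ≡ suc (j ℕ.+ a) → p ℕ.∣ c ℕ.+ suc j →
    punctured c j a ≡ + ((a ℕ.+ j) !) [mod p ]
  punctured≡[p-1]! {p} c j a p≡1+j+a (ℕ.divides q c+1+j≡q*pₙ) = begin
    + (c ℕ.+ j) ↓ j * + (c ℕ.+ suc (j ℕ.+ a)) ↓ a  ≈⟨ mod-*-cong (↓-cong j c+j≡-1) (↓-cong a top≡a) ⟩
    -1ℤ ↓ j * + a ↓ a                              ≡⟨ cong₂ _*_ (-1↓c≡±c! j) (n↓n≡n! a) ⟩
    -1ℤ ^ j * + (j !) * + (a !)                    ≈⟨ mod-sym (wilson-split a j a+j+1≡p) ⟩
    + ((a ℕ.+ j) !)                                ∎
    where
    open ≡-mod-Reasoning p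
    c+1+j≡q*p : + (c ℕ.+ suc j) ≡ + q * + p
    c+1+j≡q*p = trans (cong +_ c+1+j≡q*pₙ) (pos-* q p)
    c+j≡-1 : + (c ℕ.+ j) ≡ -1ℤ [mod p ]
    c+j≡-1 = mod-intro (divides (+ q) (trans (cong +_ (trans (ℕ.+-assoc c j 1) (cong (c ℕ.+_) (ℕ.+-comm j 1)))) c+1+j≡q*p))
    top≡a : + (c ℕ.+ suc (j ℕ.+ a)) ≡ + a [mod p ]
    top≡a = mod-intro (divides (+ q) (trans (cong (λ n → + n - + a) (sym (ℕ.+-assoc c (suc j) a))) (trans (+[m+n]-+n≡+m (c ℕ.+ suc j) a) c+1+j≡q*p)))
    a+j+1≡p : a ℕ.+ j ℕ.+ 1 ≡ p
    a+j+1≡p = trans (ℕ.+-comm (a ℕ.+ j) 1) (trans (cong suc (ℕ.+-comm a j)) (sym p≡1+j+a))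

module RationalEmbedding where

  open import Data.Nat as ℕ using (ℕ; zero; suc)
  import Data.Nat.Properties as ℕ
  import Data.Nat.Divisibility as ℕ
  open import Data.Nat.Coprimality as Coprimality using (Coprime)
  open import Data.Nat.Primality using (Prime; prime⇒irreducible)
  open import Data.Integer as ℤ using (ℤ; +_; -[1+_]; -1ℤ; _^_)
  import Data.Integer.Properties as ℤ
  open import Data.Integer.Divisibility.Signed as ℤ using (divides)
  open import Data.Integer.Tactic.RingSolver using (solve-∀)
  open import Data.Rational as ℚ using (ℚ; mkℚ; 0ℚ; 1ℚ; _+_; _*_; _-_; -_; 1/_; toℚᵘ; ↥_; ↧_; ↧ₙ_)
  open import Data.Rational.Properties as ℚ using (_≟_; toℚᵘ-injective)
  open import Data.Rational.Unnormalised as ℚᵘ using (ℚᵘ; mkℚᵘ; *≡*)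
  import Data.Rational.Unnormalised.Properties as ℚᵘ
  open import Data.Rational.Solver using (module +-*-Solver)
  open import Data.Product using (_,_)
  open import Data.Sum using (inj₁; inj₂)
  open import Data.Empty using (⊥-elim)
  open import Relation.Nullary using (¬_; yes; no)
  open import Relation.Binary.PropositionalEquality
  open import Defs
  open IntegerCongruence

  toℚᵘ-ℤtoℚ : ∀ z → toℚᵘ (ℤtoℚ z) ≡ mkℚᵘ z 0
  toℚᵘ-ℤtoℚ (+ n)    = cong toℚᵘ (ℚ.normalize-coprime {n} {0} (Coprimality.sym (Coprimality.1-coprimeTo n)))
  toℚᵘ-ℤtoℚ -[1+ n ] = cong (λ q → toℚᵘ (- q)) (ℚ.normalize-coprime {suc n} {0} (Coprimality.sym (Coprimality.1-coprimeTo (suc n))))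

  ℤtoℚ-homo-+ : ∀ a b → ℤtoℚ (a ℤ.+ b) ≡ ℤtoℚ a + ℤtoℚ b
  ℤtoℚ-homo-+ a b = toℚᵘ-injective (begin
    toℚᵘ (ℤtoℚ (a ℤ.+ b))                     ≡⟨ toℚᵘ-ℤtoℚ (a ℤ.+ b) ⟩
    mkℚᵘ (a ℤ.+ b) 0                          ≈⟨ *≡* (e a b) ⟩
    mkℚᵘ a 0 ℚᵘ.+ mkℚᵘ b 0                    ≡⟨ cong₂ ℚᵘ._+_ (toℚᵘ-ℤtoℚ a) (toℚᵘ-ℤtoℚ b) ⟨
    toℚᵘ (ℤtoℚ a) ℚᵘ.+ toℚᵘ (ℤtoℚ b)          ≈⟨ ℚ.toℚᵘ-homo-+ (ℤtoℚ a) (ℤtoℚ b) ⟨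
    toℚᵘ (ℤtoℚ a + ℤtoℚ b)                    ∎)
    where
    open ℚᵘ.≃-Reasoning
    e : ∀ a b → (a ℤ.+ b) ℤ.* + 1 ≡ (a ℤ.* + 1 ℤ.+ b ℤ.* + 1) ℤ.* + 1
    e = solve-∀

  ℤtoℚ-homo-* : ∀ a b → ℤtoℚ (a ℤ.* b) ≡ ℤtoℚ a * ℤtoℚ b
  ℤtoℚ-homo-* a b = toℚᵘ-injective (begin
    toℚᵘ (ℤtoℚ (a ℤ.* b))                     ≡⟨ toℚᵘ-ℤtoℚ (a ℤ.* b) ⟩
    mkℚᵘ a 0 ℚᵘ.* mkℚᵘ b 0                    ≡⟨ cong₂ ℚᵘ._*_ (toℚᵘ-ℤtoℚ a) (toℚᵘ-ℤtoℚ b) ⟨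
    toℚᵘ (ℤtoℚ a) ℚᵘ.* toℚᵘ (ℤtoℚ b)          ≈⟨ ℚ.toℚᵘ-homo-* (ℤtoℚ a) (ℤtoℚ b) ⟨
    toℚᵘ (ℤtoℚ a * ℤtoℚ b)                    ∎)
    where open ℚᵘ.≃-Reasoning

  ℤtoℚ-homo‿- : ∀ a → ℤtoℚ (ℤ.- a) ≡ - ℤtoℚ a
  ℤtoℚ-homo‿- a = toℚᵘ-injective (begin
    toℚᵘ (ℤtoℚ (ℤ.- a))                       ≡⟨ toℚᵘ-ℤtoℚ (ℤ.- a) ⟩
    ℚᵘ.- mkℚᵘ a 0                             ≡⟨ cong ℚᵘ.-_ (toℚᵘ-ℤtoℚ a) ⟨
    ℚᵘ.- toℚᵘ (ℤtoℚ a)                        ≈⟨ ℚ.toℚᵘ-homo‿- (ℤtoℚ a) ⟨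
    toℚᵘ (- ℤtoℚ a)                           ∎)
    where open ℚᵘ.≃-Reasoning

  ℤtoℚ-homo-minus : ∀ a b → ℤtoℚ (a ℤ.- b) ≡ ℤtoℚ a - ℤtoℚ b
  ℤtoℚ-homo-minus a b = trans (ℤtoℚ-homo-+ a (ℤ.- b)) (cong (λ q → ℤtoℚ a + q) (ℤtoℚ-homo‿- b))

  ℤtoℚ-injective : ∀ {a b} → ℤtoℚ a ≡ ℤtoℚ b → a ≡ b
  ℤtoℚ-injective {a} {b} eq = cong ℚᵘ.↥_ (trans (sym (toℚᵘ-ℤtoℚ a)) (trans (cong toℚᵘ eq) (toℚᵘ-ℤtoℚ b)))

  ℤtoℚ-≢0 : ∀ {a} → a ≢ + 0 → ℤtoℚ a ≢ 0ℚ
  ℤtoℚ-≢0 a≢0 eq = a≢0 (ℤtoℚ-injective eq)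


  ℕtoℚ-homo-* : ∀ m n → ℕtoℚ (m ℕ.* n) ≡ ℕtoℚ m * ℕtoℚ n
  ℕtoℚ-homo-* m n = trans (cong ℤtoℚ (ℤ.pos-* m n)) (ℤtoℚ-homo-* (+ m) (+ n))

  ℕtoℚ-≢0 : ∀ n → .{{ℕ.NonZero n}} → ℕtoℚ n ≢ 0ℚ
  ℕtoℚ-≢0 (suc n) = ℤtoℚ-≢0 {+ suc n} (λ ())

  sgn≡ℤtoℚ[-1^] : ∀ m → sgn m ≡ ℤtoℚ (-1ℤ ^ m)
  sgn≡ℤtoℚ[-1^] zero    = refl
  sgn≡ℤtoℚ[-1^] (suc m) = begin
    - 1ℚ * sgn m                    ≡⟨ cong (- 1ℚ *_) (sgn≡ℤtoℚ[-1^] m) ⟩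
    - 1ℚ * ℤtoℚ (-1ℤ ^ m)           ≡⟨ ℤtoℚ-homo-* -1ℤ (-1ℤ ^ m) ⟨
    ℤtoℚ (-1ℤ ^ suc m)              ∎
    where open ≡-Reasoning

  x//y*y≡x : ∀ x {y} → y ≢ 0ℚ → (x // y) * y ≡ x
  x//y*y≡x x {y} y≢0 with y ≟ 0ℚ
  ... | yes y≡0 = ⊥-elim (y≢0 y≡0)
  ... | no  y≢0′ = begin
    x * 1/ y * y      ≡⟨ ℚ.*-assoc x (1/ y) y ⟩
    x * (1/ y * y)    ≡⟨ cong (x *_) (ℚ.*-inverseˡ y) ⟩
    x * 1ℚ            ≡⟨ ℚ.*-identityʳ x ⟩
    x                 ∎
    where
    open ≡-Reasoning
    instance _ = ℚ.≢-nonZero y≢0′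

  x*y//y≡x : ∀ x {y} → y ≢ 0ℚ → (x * y) // y ≡ x
  x*y//y≡x x {y} y≢0 with y ≟ 0ℚ
  ... | yes y≡0 = ⊥-elim (y≢0 y≡0)
  ... | no  y≢0′ = begin
    x * y * 1/ y      ≡⟨ ℚ.*-assoc x y (1/ y) ⟩
    x * (y * 1/ y)    ≡⟨ cong (x *_) (ℚ.*-inverseʳ y) ⟩
    x * 1ℚ            ≡⟨ ℚ.*-identityʳ x ⟩
    x                 ∎
    where
    open ≡-Reasoning
    instance _ = ℚ.≢-nonZero y≢0′

  *-cancelʳ-≡ : ∀ x y {z} → z ≢ 0ℚ → x * z ≡ y * z → x ≡ y
  *-cancelʳ-≡ x y {z} z≢0 eq = begin
    x                  ≡⟨ x*y//y≡x x z≢0 ⟨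
    x * z // z         ≡⟨ cong (_// z) eq ⟩
    y * z // z         ≡⟨ x*y//y≡x y z≢0 ⟩
    y                  ∎
    where open ≡-Reasoning

  q*w≡e⇒↥q*w≡e*↧q : ∀ q w e → q * ℤtoℚ w ≡ ℤtoℚ e → ↥ q ℤ.* w ≡ e ℤ.* ↧ q
  q*w≡e⇒↥q*w≡e*↧q q@(mkℚ n d-1 _) w e eq =
    trans (sym (ℤ.*-identityʳ (n ℤ.* w)))
          (trans (ℚᵘ.drop-*≡* q*w≃e) (cong (λ k → e ℤ.* + suc k) (ℕ.*-identityʳ d-1)))
    where
    q*w≃e : toℚᵘ q ℚᵘ.* mkℚᵘ w 0 ℚᵘ.≃ mkℚᵘ e 0
    q*w≃e = begin
      toℚᵘ q ℚᵘ.* mkℚᵘ w 0           ≡⟨ cong (toℚᵘ q ℚᵘ.*_) (toℚᵘ-ℤtoℚ w) ⟨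
      toℚᵘ q ℚᵘ.* toℚᵘ (ℤtoℚ w)      ≈⟨ ℚ.toℚᵘ-homo-* q (ℤtoℚ w) ⟨
      toℚᵘ (q * ℤtoℚ w)              ≡⟨ cong toℚᵘ eq ⟩
      toℚᵘ (ℤtoℚ e)                  ≡⟨ toℚᵘ-ℤtoℚ e ⟩
      mkℚᵘ e 0                       ∎
      where open ℚᵘ.≃-Reasoning

  q*w≡e⇒↧q∣w : ∀ q w e → q * ℤtoℚ w ≡ ℤtoℚ e → ↧ₙ q ℕ.∣ ℤ.∣ w ∣
  q*w≡e⇒↧q∣w q@(mkℚ n d-1 n⊥d) w e eq =
    Coprimality.coprime-divisor (Coprimality.sym (Coprimality.recompute n⊥d)) (ℕ.divides ℤ.∣ e ∣ (begin
      ℤ.∣ n ∣ ℕ.* ℤ.∣ w ∣         ≡⟨ ℤ.abs-* n w ⟨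
      ℤ.∣ n ℤ.* w ∣               ≡⟨ cong ℤ.∣_∣ (q*w≡e⇒↥q*w≡e*↧q q w e eq) ⟩
      ℤ.∣ e ℤ.* + suc d-1 ∣       ≡⟨ ℤ.abs-* e (+ suc d-1) ⟩
      ℤ.∣ e ∣ ℕ.* suc d-1         ∎))
    where open ≡-Reasoning

  ≡[mod]⇒CongQ : ∀ {p} → Prime p → ∀ x y a b c d →
    x * ℤtoℚ b ≡ ℤtoℚ a → y * ℤtoℚ d ≡ ℤtoℚ c → ¬ (+ p ℤ.∣ b) → ¬ (+ p ℤ.∣ d) →
    a ℤ.* d ≡ c ℤ.* b [mod p ] → CongQ p x y
  ≡[mod]⇒CongQ {p} p-prime x y a b c d x*b≡a y*d≡c p∤b p∤d (mod-intro (divides k ad-cb≡k*p)) =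
    q , x-y≡p*q , ↧q⊥p
    where
    open +-*-Solver using (solve; _:-_; _:*_; _:=_)
    B D P : ℚ
    B = ℤtoℚ b
    D = ℤtoℚ d
    P = ℕtoℚ p
    p∤bd : ¬ (+ p ℤ.∣ b ℤ.* d)
    p∤bd = prime∤* p-prime p∤b p∤d
    BD≢0 : ℤtoℚ (b ℤ.* d) ≢ 0ℚ
    BD≢0 = ℤtoℚ-≢0 (∤⇒≢0 p∤bd)
    q : ℚ
    q = ℤtoℚ k // ℤtoℚ (b ℤ.* d)
    [x-y]*BD≡P*k : (x - y) * ℤtoℚ (b ℤ.* d) ≡ P * ℤtoℚ k
    [x-y]*BD≡P*k = begin
      (x - y) * ℤtoℚ (b ℤ.* d)              ≡⟨ cong ((x - y) *_) (ℤtoℚ-homo-* b d) ⟩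
      (x - y) * (B * D)                     ≡⟨ solve 4 (λ x y B D → (x :- y) :* (B :* D) := (x :* B) :* D :- (y :* D) :* B) refl x y B D ⟩
      (x * B) * D - (y * D) * B             ≡⟨ cong₂ (λ u v → u * D - v * B) x*b≡a y*d≡c ⟩
      ℤtoℚ a * D - ℤtoℚ c * B               ≡⟨ cong₂ _-_ (ℤtoℚ-homo-* a d) (ℤtoℚ-homo-* c b) ⟨
      ℤtoℚ (a ℤ.* d) - ℤtoℚ (c ℤ.* b)       ≡⟨ ℤtoℚ-homo-minus (a ℤ.* d) (c ℤ.* b) ⟨
      ℤtoℚ (a ℤ.* d ℤ.- c ℤ.* b)            ≡⟨ cong ℤtoℚ ad-cb≡k*p ⟩
      ℤtoℚ (k ℤ.* + p)                      ≡⟨ ℤtoℚ-homo-* k (+ p) ⟩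
      ℤtoℚ k * P                            ≡⟨ ℚ.*-comm (ℤtoℚ k) P ⟩
      P * ℤtoℚ k                            ∎
      where open ≡-Reasoning
    q*BD≡k : q * ℤtoℚ (b ℤ.* d) ≡ ℤtoℚ k
    q*BD≡k = x//y*y≡x (ℤtoℚ k) BD≢0
    x-y≡p*q : x - y ≡ P * q
    x-y≡p*q = *-cancelʳ-≡ (x - y) (P * q) BD≢0
      (trans [x-y]*BD≡P*k (trans (cong (P *_) (sym q*BD≡k)) (sym (ℚ.*-assoc P q _))))
    ↧q⊥p : Coprime (↧ₙ q) p
    ↧q⊥p {g} (g∣↧q , g∣p) with prime⇒irreducible p-prime g∣p
    ... | inj₁ g≡1 = g≡1
    ... | inj₂ refl = ⊥-elim (p∤bd (ℤ.∣ᵤ⇒∣ (ℕ.∣-trans g∣↧q (q*w≡e⇒↧q∣w q (b ℤ.* d) k q*BD≡k))))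

module BinomialCoefficients where

  open import Data.Nat as ℕ using (ℕ; zero; suc; _!)
  import Data.Nat.Properties as ℕ
  open import Data.Nat.DivMod using (m/n*n≡m)
  open import Data.Nat.Combinatorics using (_C_; nCk≡n!/k![n-k]!; k![n∸k]!∣n!; k>n⇒nCk≡0)
  import Data.Nat.Tactic.RingSolver as ℕ-Solver
  open import Data.Integer as ℤ using (ℤ; +_)
  import Data.Integer.Properties as ℤ
  open import Data.Rational using (_*_; _-_)
  open import Data.Product using (_,_)
  open import Data.Nat.Primality using (Prime)
  open import Relation.Binary.Definitions using (tri<; tri≈; tri>)
  open import Relation.Binary.PropositionalEquality
  open import Defs
  open IntegerCongruence
  open FallingFactorial
  open RationalEmbedding

  [k+r]Ck*k!*r!≡[k+r]! : ∀ k r → ((k ℕ.+ r) C k) ℕ.* (k ! ℕ.* r !) ≡ (k ℕ.+ r) !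
  [k+r]Ck*k!*r!≡[k+r]! k r = subst (λ x → ((k ℕ.+ r) C k) ℕ.* (k ! ℕ.* x !) ≡ (k ℕ.+ r) !)
    (ℕ.m+n∸m≡n k r)
    (trans (cong (ℕ._* (k ! ℕ.* (n ℕ.∸ k) !)) (nCk≡n!/k![n-k]! k≤n))
           (m/n*n≡m ⦃ ℕ.m*n≢0 (k !) ((n ℕ.∸ k) !) ⦃ ℕ._!≢0 k ⦄ ⦃ ℕ._!≢0 (n ℕ.∸ k) ⦄ ⦄ (k![n∸k]!∣n! k≤n)))
    where
    n : ℕ
    n = k ℕ.+ r
    k≤n : k ℕ.≤ n
    k≤n = ℕ.m≤m+n k r

  absorption : ∀ l r → ((l ℕ.+ suc r) C l) ℕ.* suc r ≡ ((l ℕ.+ suc r) C suc l) ℕ.* suc l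
  absorption l r = ℕ.*-cancelʳ-≡ _ _ (l ! ℕ.* r !) ⦃ ℕ.m*n≢0 (l !) (r !) ⦃ ℕ._!≢0 l ⦄ ⦃ ℕ._!≢0 r ⦄ ⦄ (begin
    (n C l) ℕ.* suc r ℕ.* (l ! ℕ.* r !)       ≡⟨ e₁ (n C l) (l !) (suc r) (r !) ⟩
    (n C l) ℕ.* (l ! ℕ.* (suc r) !)           ≡⟨ [k+r]Ck*k!*r!≡[k+r]! l (suc r) ⟩
    n !                                       ≡⟨ cong _! (ℕ.+-suc l r) ⟩
    (suc l ℕ.+ r) !                           ≡⟨ [k+r]Ck*k!*r!≡[k+r]! (suc l) r ⟨
    ((suc l ℕ.+ r) C suc l) ℕ.* ((suc l) ! ℕ.* r !) ≡⟨ cong (λ x → (x C suc l) ℕ.* ((suc l) ! ℕ.* r !)) (ℕ.+-suc l r) ⟨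
    (n C suc l) ℕ.* ((suc l) ! ℕ.* r !)       ≡⟨ e₂ (n C suc l) (suc l) (l !) (r !) ⟨
    (n C suc l) ℕ.* suc l ℕ.* (l ! ℕ.* r !)   ∎)
    where
    open ≡-Reasoning
    n : ℕ
    n = l ℕ.+ suc r
    e₁ : ∀ c a b d → c ℕ.* b ℕ.* (a ℕ.* d) ≡ c ℕ.* (a ℕ.* (b ℕ.* d))
    e₁ = ℕ-Solver.solve-∀
    e₂ : ∀ c a b d → c ℕ.* a ℕ.* (b ℕ.* d) ≡ c ℕ.* (a ℕ.* b ℕ.* d)
    e₂ = ℕ-Solver.solve-∀

  nC[k+1]*[k+1]≡nCk*[n-k] : ∀ n k → + (n C suc k) ℤ.* + suc k ≡ + (n C k) ℤ.* (+ n ℤ.- + k)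
  nC[k+1]*[k+1]≡nCk*[n-k] n k with ℕ.<-cmp k n
  ... | tri< k<n _ _ with ℕ.m≤n⇒∃[o]m+o≡n k<n
  ...   | r , refl = begin
    + (n C suc k) ℤ.* + suc k     ≡⟨ ℤ.pos-* (n C suc k) (suc k) ⟨
    + ((n C suc k) ℕ.* suc k)     ≡⟨ cong +_ (absorption′ k r) ⟨
    + ((n C k) ℕ.* suc r)         ≡⟨ ℤ.pos-* (n C k) (suc r) ⟩
    + (n C k) ℤ.* + suc r         ≡⟨ cong (+ (n C k) ℤ.*_) (trans (cong (λ x → + x ℤ.- + k) (sym (ℕ.+-suc k r))) (+[m+n]-+m≡+n k (suc r))) ⟨
    + (n C k) ℤ.* (+ n ℤ.- + k)   ∎
    where
    open ≡-Reasoning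
    absorption′ : ∀ k r → ((suc k ℕ.+ r) C k) ℕ.* suc r ≡ ((suc k ℕ.+ r) C suc k) ℕ.* suc k
    absorption′ k r = subst (λ x → (x C k) ℕ.* suc r ≡ (x C suc k) ℕ.* suc k) (ℕ.+-suc k r) (absorption k r)
  nC[k+1]*[k+1]≡nCk*[n-k] n k | tri≈ _ refl _
    rewrite k>n⇒nCk≡0 (ℕ.n<1+n n) | ℤ.+-inverseʳ (+ n) = sym (ℤ.*-zeroʳ (+ (n C n)))
  nC[k+1]*[k+1]≡nCk*[n-k] n k | tri> _ _ n<k
    rewrite k>n⇒nCk≡0 (ℕ.m<n⇒m<1+n n<k) | k>n⇒nCk≡0 n<k = refl

  nCm*c!≡n↓c : ∀ {n} m c → n ≡ m ℕ.+ c → + (n C m) ℤ.* + (c !) ≡ + n ↓ c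
  nCm*c!≡n↓c {n} m c refl = ℤ.*-cancelʳ-≡ _ _ (+ (m !)) ⦃ ℕ._!≢0 m ⦄ (begin
    + B ℤ.* + (c !) ℤ.* + (m !)     ≡⟨ ℤ.*-assoc (+ B) (+ (c !)) (+ (m !)) ⟩
    + B ℤ.* (+ (c !) ℤ.* + (m !))   ≡⟨ cong (+ B ℤ.*_) (ℤ.*-comm (+ (c !)) (+ (m !))) ⟩
    + B ℤ.* (+ (m !) ℤ.* + (c !))   ≡⟨ cong (+ B ℤ.*_) (ℤ.pos-* (m !) (c !)) ⟨
    + B ℤ.* + (m ! ℕ.* c !)         ≡⟨ ℤ.pos-* B (m ! ℕ.* c !) ⟨
    + (B ℕ.* (m ! ℕ.* c !))         ≡⟨ cong +_ ([k+r]Ck*k!*r!≡[k+r]! m c) ⟩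
    + ((m ℕ.+ c) !)                 ≡⟨ [m+c]!≡[m+c]↓c*m! m c ⟩
    + (m ℕ.+ c) ↓ c ℤ.* + (m !)     ∎)
    where
    open ≡-Reasoning
    B : ℕ
    B = (m ℕ.+ c) C m

  [pM+t+d]C[pM+t]≡[t+d]Ct : ∀ {p} → Prime p → ∀ M t d → d ℕ.< p →
    + ((p ℕ.* M ℕ.+ t ℕ.+ d) C (p ℕ.* M ℕ.+ t)) ≡ + ((t ℕ.+ d) C t) [mod p ]
  [pM+t+d]C[pM+t]≡[t+d]Ct {p} p-prime M t d d<p = mod-*-cancelˡ p-prime (+ (d !)) (prime∤! p-prime d d<p) (begin
    + (d !) ℤ.* + B₁              ≡⟨ ℤ.*-comm (+ (d !)) (+ B₁) ⟩
    + B₁ ℤ.* + (d !)              ≡⟨ nCm*c!≡n↓c (p ℕ.* M ℕ.+ t) d refl ⟩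
    + (p ℕ.* M ℕ.+ t ℕ.+ d) ↓ d   ≈⟨ ↓-cong d pM+t+d≡t+d ⟩
    + (t ℕ.+ d) ↓ d               ≡⟨ nCm*c!≡n↓c t d refl ⟨
    + B₂ ℤ.* + (d !)              ≡⟨ ℤ.*-comm (+ B₂) (+ (d !)) ⟩
    + (d !) ℤ.* + B₂              ∎)
    where
    open ≡-mod-Reasoning p
    B₁ B₂ : ℕ
    B₁ = (p ℕ.* M ℕ.+ t ℕ.+ d) C (p ℕ.* M ℕ.+ t)
    B₂ = (t ℕ.+ d) C t
    pM+t+d≡t+d : + (p ℕ.* M ℕ.+ t ℕ.+ d) ≡ + (t ℕ.+ d) [mod p ]
    pM+t+d≡t+d = subst (_≡ + (t ℕ.+ d) [mod p ])
      (trans (cong (ℤ._+ + (t ℕ.+ d)) (sym (ℤ.pos-* p M))) (trans (sym (ℤ.pos-+ (p ℕ.* M) (t ℕ.+ d))) (cong +_ (sym (ℕ.+-assoc (p ℕ.* M) t d)))))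
      (multiple+a≡a (+ M) (+ (t ℕ.+ d)))

  binomQ-ℕ : ∀ n k → binomQ (ℕtoℚ n) k ≡ ℕtoℚ (n C k)
  binomQ-ℕ n zero    = refl
  binomQ-ℕ n (suc k) = begin
    binomQ (ℕtoℚ n) k * (ℕtoℚ n - ℕtoℚ k) // ℕtoℚ (suc k)   ≡⟨ cong (λ b → b * (ℕtoℚ n - ℕtoℚ k) // ℕtoℚ (suc k)) (binomQ-ℕ n k) ⟩
    ℕtoℚ (n C k) * (ℕtoℚ n - ℕtoℚ k) // ℕtoℚ (suc k)        ≡⟨ cong (_// ℕtoℚ (suc k)) recurrence ⟨
    ℕtoℚ (n C suc k) * ℕtoℚ (suc k) // ℕtoℚ (suc k)         ≡⟨ x*y//y≡x (ℕtoℚ (n C suc k)) (ℕtoℚ-≢0 (suc k)) ⟩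
    ℕtoℚ (n C suc k)                                         ∎
    where
    open ≡-Reasoning
    recurrence : ℕtoℚ (n C suc k) * ℕtoℚ (suc k) ≡ ℕtoℚ (n C k) * (ℕtoℚ n - ℕtoℚ k)
    recurrence = begin
      ℕtoℚ (n C suc k) * ℕtoℚ (suc k)             ≡⟨ ℤtoℚ-homo-* (+ (n C suc k)) (+ suc k) ⟨
      ℤtoℚ (+ (n C suc k) ℤ.* + suc k)            ≡⟨ cong ℤtoℚ (nC[k+1]*[k+1]≡nCk*[n-k] n k) ⟩
      ℤtoℚ (+ (n C k) ℤ.* (+ n ℤ.- + k))          ≡⟨ ℤtoℚ-homo-* (+ (n C k)) (+ n ℤ.- + k) ⟩
      ℕtoℚ (n C k) * ℤtoℚ (+ n ℤ.- + k)           ≡⟨ cong (ℕtoℚ (n C k) *_) (ℤtoℚ-homo-minus (+ n) (+ k)) ⟩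
      ℕtoℚ (n C k) * (ℕtoℚ n - ℕtoℚ k)            ∎

module PuncturedProducts where

  open import Data.Nat as ℕ using (ℕ; zero; suc; _≡ᵇ_)
  import Data.Nat.Properties as ℕ
  open import Data.Integer as ℤ using (+_; 1ℤ)
  open import Data.Rational using (ℚ; 1ℚ; _*_)
  import Data.Rational.Properties as ℚ
  open import Data.Bool using (true; false; if_then_else_; T)
  open import Data.Unit using (tt)
  open import Data.Empty using (⊥-elim)
  open import Relation.Binary.PropositionalEquality
  open import Defs
  open FallingFactorial
  open RationalEmbedding

  prodFrom1-+ : ∀ m n f → prodFrom1 (m ℕ.+ n) f ≡ prodFrom1 m f * prodFrom1 n (λ i → f (m ℕ.+ i))
  prodFrom1-+ m zero    f = trans (cong (λ k → prodFrom1 k f) (ℕ.+-identityʳ m)) (sym (ℚ.*-identityʳ _))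
  prodFrom1-+ m (suc n) f rewrite ℕ.+-suc m n =
    trans (cong (_* f (suc (m ℕ.+ n))) (prodFrom1-+ m n f)) (ℚ.*-assoc (prodFrom1 m f) _ _)

  prodFrom1-cong : ∀ m f g → (∀ i → i ℕ.< m → f (suc i) ≡ g (suc i)) → prodFrom1 m f ≡ prodFrom1 m g
  prodFrom1-cong zero    f g f≗g = refl
  prodFrom1-cong (suc m) f g f≗g =
    cong₂ _*_ (prodFrom1-cong m f g (λ i i<m → f≗g i (ℕ.m<n⇒m<1+n i<m))) (f≗g m (ℕ.n<1+n m))

  prodFrom1-consecutive : ∀ c m → prodFrom1 m (λ i → ℕtoℚ (c ℕ.+ i)) ≡ ℤtoℚ (+ (c ℕ.+ m) ↓ m)
  prodFrom1-consecutive c zero    = refl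
  prodFrom1-consecutive c (suc m) = begin
    prodFrom1 m (λ i → ℕtoℚ (c ℕ.+ i)) * ℕtoℚ (c ℕ.+ suc m)        ≡⟨ cong (_* ℕtoℚ (c ℕ.+ suc m)) (prodFrom1-consecutive c m) ⟩
    ℤtoℚ (+ (c ℕ.+ m) ↓ m) * ℕtoℚ (c ℕ.+ suc m)                    ≡⟨ ℚ.*-comm (ℤtoℚ (+ (c ℕ.+ m) ↓ m)) (ℕtoℚ (c ℕ.+ suc m)) ⟩
    ℕtoℚ (c ℕ.+ suc m) * ℤtoℚ (+ (c ℕ.+ m) ↓ m)                    ≡⟨ ℤtoℚ-homo-* (+ (c ℕ.+ suc m)) (+ (c ℕ.+ m) ↓ m) ⟨
    ℤtoℚ (+ (c ℕ.+ suc m) ℤ.* + (c ℕ.+ m) ↓ m)                     ≡⟨ cong (λ x → ℤtoℚ (+ (c ℕ.+ suc m) ℤ.* x ↓ m)) (+[m+1+n]-1≡+[m+n] c m) ⟨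
    ℤtoℚ (+ (c ℕ.+ suc m) ℤ.* (+ (c ℕ.+ suc m) ℤ.- 1ℤ) ↓ m)        ∎
    where open ≡-Reasoning

  private
    if-≡ᵇ-refl : ∀ {A : Set} i {x y : A} → (if i ≡ᵇ i then x else y) ≡ x
    if-≡ᵇ-refl i with i ≡ᵇ i in eq
    ... | true  = refl
    ... | false = ⊥-elim (subst T eq (ℕ.≡⇒≡ᵇ i i refl))

    if-≡ᵇ-≢ : ∀ {A : Set} {i j} {x y : A} → i ≢ j → (if i ≡ᵇ j then x else y) ≡ y
    if-≡ᵇ-≢ {i = i} {j} i≢j with i ≡ᵇ j in eq
    ... | true  = ⊥-elim (i≢j (ℕ.≡ᵇ⇒≡ i j (subst T (sym eq) tt)))
    ... | false = refl

  prodExcept≡punctured : ∀ c j a →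
    prodExcept (suc (j ℕ.+ a)) (suc j) (λ i → ℕtoℚ (c ℕ.+ i)) ≡ ℤtoℚ (punctured c j a)
  prodExcept≡punctured c j a = begin
    prodFrom1 (suc j ℕ.+ a) h
      ≡⟨ prodFrom1-+ (suc j) a h ⟩
    prodFrom1 j h * h (suc j) * prodFrom1 a (λ i → h (suc j ℕ.+ i))
      ≡⟨ cong₂ (λ x y → x * y * prodFrom1 a (λ i → h (suc j ℕ.+ i))) below (if-≡ᵇ-refl (suc j)) ⟩
    prodFrom1 j g * 1ℚ * prodFrom1 a (λ i → h (suc j ℕ.+ i))
      ≡⟨ cong₂ _*_ (ℚ.*-identityʳ (prodFrom1 j g)) above ⟩
    prodFrom1 j g * prodFrom1 a (λ i → ℕtoℚ (c ℕ.+ suc j ℕ.+ i))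
      ≡⟨ cong₂ _*_ (prodFrom1-consecutive c j) (prodFrom1-consecutive (c ℕ.+ suc j) a) ⟩
    ℤtoℚ (+ (c ℕ.+ j) ↓ j) * ℤtoℚ (+ (c ℕ.+ suc j ℕ.+ a) ↓ a)
      ≡⟨ cong (λ k → ℤtoℚ (+ (c ℕ.+ j) ↓ j) * ℤtoℚ (+ k ↓ a)) (ℕ.+-assoc c (suc j) a) ⟩
    ℤtoℚ (+ (c ℕ.+ j) ↓ j) * ℤtoℚ (+ (c ℕ.+ suc (j ℕ.+ a)) ↓ a)
      ≡⟨ ℤtoℚ-homo-* (+ (c ℕ.+ j) ↓ j) _ ⟨
    ℤtoℚ (punctured c j a)
      ∎
    where
    open ≡-Reasoning
    g : ℕ → ℚ
    g i = ℕtoℚ (c ℕ.+ i)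
    h : ℕ → ℚ
    h i = if i ≡ᵇ suc j then 1ℚ else g i
    below : prodFrom1 j h ≡ prodFrom1 j g
    below = prodFrom1-cong j h g (λ i i<j → if-≡ᵇ-≢ (λ 1+i≡1+j → ℕ.<-irrefl (ℕ.suc-injective 1+i≡1+j) i<j))
    above : prodFrom1 a (λ i → h (suc j ℕ.+ i)) ≡ prodFrom1 a (λ i → ℕtoℚ (c ℕ.+ suc j ℕ.+ i))
    above = prodFrom1-cong a _ _ (λ i _ → trans (if-≡ᵇ-≢ (ℕ.m+1+n≢m (suc j)))
                                               (cong ℕtoℚ (sym (ℕ.+-assoc c (suc j) (suc i)))))

module BraceEvaluation where

  open import Data.Nat as ℕ using (ℕ; zero; suc; NonZero)
  import Data.Nat.Properties as ℕ
  import Data.Nat.Divisibility as ℕ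
  open import Data.Nat.DivMod using (/-congˡ; /-congʳ; m*n/o*n≡m/o; m/n≡1+[m∸n]/n; m<n⇒m/n≡0)
  open import Data.Nat.Combinatorics using (_C_; k>n⇒nCk≡0; nCn≡1; nC1≡n; nCk≡nC[n∸k])
  import Data.Nat.Tactic.RingSolver as ℕ-Solver
  open import Data.Integer as ℤ using (ℤ; +_; -[1+_]; -1ℤ; _^_)
  import Data.Integer.Properties as ℤ
  open import Data.Integer.Divisibility.Signed as ℤ using (divides; _∣?_)
  open import Data.Integer.Tactic.RingSolver using (solve-∀)
  open import Data.Rational as ℚ using (ℚ; mkℚ; 0ℚ; 1ℚ; _+_; _*_; _-_)
  import Data.Rational.Properties as ℚ
  open import Data.Rational.Solver using (module +-*-Solver)
  open import Data.Product using (_,_)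
  open import Data.Sum using (inj₁; inj₂)
  open import Data.Empty using (⊥-elim)
  open import Relation.Nullary using (¬_; yes; no)
  open import Relation.Binary.PropositionalEquality
  open import Defs
  open FallingFactorial using (+[m+n]-+n≡+m; +[m+n]-+m≡+n; 1+n-1≡n)
  open RationalEmbedding
  open BinomialCoefficients using (binomQ-ℕ)

  sumTo-initial-zeros : ∀ K f → (∀ k → k ℕ.< K → f k ≡ 0ℚ) → sumTo K f ≡ f K
  sumTo-initial-zeros zero    f zeros = refl
  sumTo-initial-zeros (suc K) f zeros = begin
    sumTo K f + f (suc K)   ≡⟨ cong (_+ f (suc K)) (sumTo-initial-zeros K f (λ k k<K → zeros k (ℕ.m<n⇒m<1+n k<K))) ⟩
    f K + f (suc K)         ≡⟨ cong (_+ f (suc K)) (zeros K (ℕ.n<1+n K)) ⟩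
    0ℚ + f (suc K)          ≡⟨ ℚ.+-identityˡ (f (suc K)) ⟩
    f (suc K)               ∎
    where open ≡-Reasoning

  sumTo-trailing-zeros : ∀ K m f → (∀ i → i ℕ.< m → f (K ℕ.+ suc i) ≡ 0ℚ) → sumTo (K ℕ.+ m) f ≡ sumTo K f
  sumTo-trailing-zeros K zero    f zeros = cong (λ n → sumTo n f) (ℕ.+-identityʳ K)
  sumTo-trailing-zeros K (suc m) f zeros rewrite ℕ.+-suc K m = begin
    sumTo (K ℕ.+ m) f + f (suc (K ℕ.+ m))   ≡⟨ cong₂ _+_ (sumTo-trailing-zeros K m f (λ i i<m → zeros i (ℕ.m<n⇒m<1+n i<m)))
                                                         (trans (cong f (sym (ℕ.+-suc K m))) (zeros m (ℕ.n<1+n m))) ⟩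
    sumTo K f + 0ℚ                          ≡⟨ ℚ.+-identityʳ (sumTo K f) ⟩
    sumTo K f                               ∎
    where open ≡-Reasoning

  floor-≡-quotient : ∀ q m a .{{_ : NonZero m}} → q * ℕtoℚ m ≡ ℕtoℚ a → ℚ.floor q ≡ + (a ℕ./ m)
  floor-≡-quotient q@(mkℚ (+ n) d-1 _) m a q*m≡a = trans (ℤ.*-identityˡ _) (cong +_ (begin
    n ℕ./ d                      ≡⟨ m*n/o*n≡m/o n m d ⟨
    n ℕ.* m ℕ./ (d ℕ.* m)        ≡⟨ /-congˡ {o = d ℕ.* m} n*m≡a*d ⟩
    a ℕ.* d ℕ./ (d ℕ.* m)        ≡⟨ /-congʳ (ℕ.*-comm d m) ⟩
    a ℕ.* d ℕ./ (m ℕ.* d)        ≡⟨ m*n/o*n≡m/o a d m ⟩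
    a ℕ./ m                      ∎))
    where
    open ≡-Reasoning
    d = suc d-1
    instance
      _ = ℕ.m*n≢0 d m
      _ = ℕ.m*n≢0 m d
    n*m≡a*d : n ℕ.* m ≡ a ℕ.* d
    n*m≡a*d = ℤ.+-injective (trans (ℤ.pos-* n m) (trans (q*w≡e⇒↥q*w≡e*↧q q (+ m) (+ a) q*m≡a) (sym (ℤ.pos-* a d))))
  floor-≡-quotient q@(mkℚ -[1+ n ] d-1 _) (suc m) a q*m≡a
    with trans (q*w≡e⇒↥q*w≡e*↧q q (+ suc m) (+ a) q*m≡a) (sym (ℤ.pos-* a (suc d-1)))
  ... | ()

  braceExp≡1 : ∀ p n′ s w → p ≡ suc (s ℕ.+ suc w) → braceExp (p ℕ.* suc n′ ℕ.+ s) n′ p ≡ + 1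
  braceExp≡1 p n′ s w refl = begin
    ℚ.floor ((ℕtoℚ N - 1ℚ - ℕtoℚ n′ * ℕtoℚ p) // (ℕtoℚ p - 1ℚ))  ≡⟨ cong₂ (λ x y → ℚ.floor (x // y)) numerator denominator ⟩
    ℚ.floor (ℕtoℚ (p′ ℕ.+ s) // ℕtoℚ p′)
      ≡⟨ floor-≡-quotient (ℕtoℚ (p′ ℕ.+ s) // ℕtoℚ p′) p′ (p′ ℕ.+ s) (x//y*y≡x _ (ℕtoℚ-≢0 p′)) ⟩
    + ((p′ ℕ.+ s) ℕ./ p′)                                          ≡⟨ cong +_ (m/n≡1+[m∸n]/n (ℕ.m≤m+n p′ s)) ⟩
    + suc ((p′ ℕ.+ s ℕ.∸ p′) ℕ./ p′)                               ≡⟨ cong (λ k → + suc (k ℕ./ p′)) (ℕ.m+n∸m≡n p′ s) ⟩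
    + suc (s ℕ./ p′)                                               ≡⟨ cong (λ k → + suc k) (m<n⇒m/n≡0 (ℕ.m<m+n s ℕ.z<s)) ⟩
    + 1                                                            ∎
    where
    open ≡-Reasoning
    p′ N : ℕ
    p′ = s ℕ.+ suc w
    N = suc p′ ℕ.* suc n′ ℕ.+ s
    instance _ = ℕ.≢-nonZero (ℕ.m+1+n≢0 s {w})
    numerator : ℕtoℚ N - 1ℚ - ℕtoℚ n′ * ℕtoℚ (suc p′) ≡ ℕtoℚ (p′ ℕ.+ s)
    numerator = begin
      ℕtoℚ N - 1ℚ - ℕtoℚ n′ * ℕtoℚ (suc p′)                 ≡⟨ cong (λ x → ℕtoℚ N - 1ℚ - x) (ℤtoℚ-homo-* (+ n′) (+ suc p′)) ⟨
      ℕtoℚ N - ℤtoℚ (+ 1) - ℤtoℚ (+ n′ ℤ.* + suc p′)       ≡⟨ cong (_- ℤtoℚ (+ n′ ℤ.* + suc p′)) (ℤtoℚ-homo-minus (+ N) (+ 1)) ⟨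
      ℤtoℚ (+ N ℤ.- + 1) - ℤtoℚ (+ n′ ℤ.* + suc p′)        ≡⟨ ℤtoℚ-homo-minus (+ N ℤ.- + 1) (+ n′ ℤ.* + suc p′) ⟨
      ℤtoℚ (+ N ℤ.- + 1 ℤ.- + n′ ℤ.* + suc p′)              ≡⟨ cong ℤtoℚ N-1-n′p≡p′+s ⟩
      ℕtoℚ (p′ ℕ.+ s)                                        ∎
      where
      e : ∀ x m s → (+ 1 ℤ.+ x) ℤ.* (+ 1 ℤ.+ m) ℤ.+ s ℤ.- + 1 ℤ.- m ℤ.* (+ 1 ℤ.+ x) ≡ x ℤ.+ s
      e = solve-∀
      +N≡[1+p′][1+n′]+s : + N ≡ (+ 1 ℤ.+ + p′) ℤ.* (+ 1 ℤ.+ + n′) ℤ.+ + s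
      +N≡[1+p′][1+n′]+s = trans (ℤ.pos-+ (suc p′ ℕ.* suc n′) s) (cong (ℤ._+ + s) (ℤ.pos-* (suc p′) (suc n′)))
      N-1-n′p≡p′+s : + N ℤ.- + 1 ℤ.- + n′ ℤ.* + suc p′ ≡ + (p′ ℕ.+ s)
      N-1-n′p≡p′+s = begin
        + N ℤ.- + 1 ℤ.- + n′ ℤ.* + suc p′                                          ≡⟨ cong (λ x → x ℤ.- + 1 ℤ.- + n′ ℤ.* + suc p′) +N≡[1+p′][1+n′]+s ⟩
        (+ 1 ℤ.+ + p′) ℤ.* (+ 1 ℤ.+ + n′) ℤ.+ + s ℤ.- + 1 ℤ.- + n′ ℤ.* (+ 1 ℤ.+ + p′) ≡⟨ e (+ p′) (+ n′) (+ s) ⟩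
        + p′ ℤ.+ + s                                                               ≡⟨ ℤ.pos-+ p′ s ⟨
        + (p′ ℕ.+ s)                                                               ∎
    denominator : ℕtoℚ (suc p′) - 1ℚ ≡ ℕtoℚ p′
    denominator = trans (sym (ℤtoℚ-homo-minus (+ suc p′) (+ 1))) (cong ℤtoℚ (1+n-1≡n p′))

  p*brace≡sum : ∀ N r l p .{{_ : NonZero p}} → braceExp N l p ≡ + 1 →
    ℕtoℚ p * brace N r l p ≡ sumTo N (braceTerm N r l p)
  p*brace≡sum N r l p exp≡1 rewrite exp≡1 = begin
    P * (1ℚ // (P * 1ℚ) * S)        ≡⟨ solve 3 (λ P I S → P :* (I :* S) := I :* (P :* con 1ℚ) :* S) refl P (1ℚ // (P * 1ℚ)) S ⟩
    1ℚ // (P * 1ℚ) * (P * 1ℚ) * S   ≡⟨ cong (_* S) (x//y*y≡x 1ℚ P*1≢0) ⟩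
    1ℚ * S                          ≡⟨ ℚ.*-identityˡ S ⟩
    S                               ∎
    where
    open ≡-Reasoning
    open +-*-Solver using (solve; _:*_; _:=_; con)
    P S : ℚ
    P = ℕtoℚ p
    S = sumTo N (braceTerm N r l p)
    P*1≢0 : P * 1ℚ ≢ 0ℚ
    P*1≢0 = subst (_≢ 0ℚ) (sym (ℚ.*-identityʳ P)) (ℕtoℚ-≢0 p)

  p*x≡e⇒x*b≡a : ∀ {p} .{{_ : NonZero p}} {x} e a b → ℕtoℚ p * x ≡ ℤtoℚ e → e ℤ.* b ≡ a ℤ.* + p →
    x * ℤtoℚ b ≡ ℤtoℚ a
  p*x≡e⇒x*b≡a {p} {x} e a b p*x≡e e*b≡a*p = *-cancelʳ-≡ (x * B) (ℤtoℚ a) (ℕtoℚ-≢0 p) (begin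
    x * B * P               ≡⟨ solve 3 (λ x B P → x :* B :* P := P :* x :* B) refl x B P ⟩
    P * x * B               ≡⟨ cong (_* B) p*x≡e ⟩
    ℤtoℚ e * B              ≡⟨ ℤtoℚ-homo-* e b ⟨
    ℤtoℚ (e ℤ.* b)          ≡⟨ cong ℤtoℚ e*b≡a*p ⟩
    ℤtoℚ (a ℤ.* + p)        ≡⟨ ℤtoℚ-homo-* a (+ p) ⟩
    ℤtoℚ a * P              ∎)
    where
    open ≡-Reasoning
    open +-*-Solver using (solve; _:*_; _:=_)
    B P : ℚ
    B = ℤtoℚ b
    P = ℕtoℚ p

  module _ (N l p : ℕ) where

    braceTerm-off : ∀ t k → ¬ (+ p ℤ.∣ + k ℤ.- + t) → braceTerm N (+ t) l p k ≡ 0ℚ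
    braceTerm-off t k p∤k-t with + p ∣? + k ℤ.- + t
    ... | yes p∣k-t = ⊥-elim (p∤k-t p∣k-t)
    ... | no  _     = refl

    braceTerm-on : .{{_ : NonZero p}} → ∀ t k j → k ≡ t ℕ.+ j ℕ.* p →
      braceTerm N (+ t) l p k ≡ ℤtoℚ (-1ℤ ^ k ℤ.* + (N C k) ℤ.* + (j C l))
    braceTerm-on t k j refl with + p ∣? + k ℤ.- + t
    ... | no p∤k-t = ⊥-elim (p∤k-t (divides (+ j) (trans (+[m+n]-+m≡+n t (j ℕ.* p)) (ℤ.pos-* j p))))
    ... | yes _ = begin
      sgn k * ℕtoℚ (N C k) * binomQ (ℤtoℚ (+ k ℤ.- + t) // ℕtoℚ p) l
          ≡⟨ cong (λ x → sgn k * ℕtoℚ (N C k) * binomQ x l) [k-t]/p≡j ⟩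
      sgn k * ℕtoℚ (N C k) * binomQ (ℕtoℚ j) l
          ≡⟨ cong₂ (λ x y → x * ℕtoℚ (N C k) * y) (sgn≡ℤtoℚ[-1^] k) (binomQ-ℕ j l) ⟩
      ℤtoℚ (-1ℤ ^ k) * ℤtoℚ (+ (N C k)) * ℤtoℚ (+ (j C l))
          ≡⟨ cong (_* ℤtoℚ (+ (j C l))) (ℤtoℚ-homo-* (-1ℤ ^ k) (+ (N C k))) ⟨
      ℤtoℚ (-1ℤ ^ k ℤ.* + (N C k)) * ℤtoℚ (+ (j C l))
          ≡⟨ ℤtoℚ-homo-* (-1ℤ ^ k ℤ.* + (N C k)) (+ (j C l)) ⟨
      ℤtoℚ (-1ℤ ^ k ℤ.* + (N C k) ℤ.* + (j C l))
          ∎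
      where
      open ≡-Reasoning
      [k-t]/p≡j : ℤtoℚ (+ k ℤ.- + t) // ℕtoℚ p ≡ ℕtoℚ j
      [k-t]/p≡j = begin
        ℤtoℚ (+ k ℤ.- + t) // ℕtoℚ p          ≡⟨ cong (λ x → ℤtoℚ x // ℕtoℚ p) (+[m+n]-+m≡+n t (j ℕ.* p)) ⟩
        ℕtoℚ (j ℕ.* p) // ℕtoℚ p              ≡⟨ cong (_// ℕtoℚ p) (ℕtoℚ-homo-* j p) ⟩
        ℕtoℚ j * ℕtoℚ p // ℕtoℚ p             ≡⟨ x*y//y≡x (ℕtoℚ j) (ℕtoℚ-≢0 p) ⟩
        ℕtoℚ j                                ∎

    private
      p∣1+n⇒p≤1+n : ∀ {n} → + p ℤ.∣ + suc n → p ℕ.≤ suc n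
      p∣1+n⇒p≤1+n p∣1+n = ℕ.∣⇒≤ (ℤ.∣⇒∣ᵤ p∣1+n)

    braceTerm-below : .{{_ : NonZero p}} → ∀ t → t ℕ.< p → ∀ k → k ℕ.< p ℕ.* l ℕ.+ t →
      braceTerm N (+ t) l p k ≡ 0ℚ
    braceTerm-below t t<p k k<K with ℕ.<-≤-connex k t
    ... | inj₁ k<t with ℕ.m≤n⇒∃[o]m+o≡n k<t
    ...   | r , refl = braceTerm-off (suc k ℕ.+ r) k p∤k-t
      where
      k-t≡-[1+r] : + k ℤ.- + (suc k ℕ.+ r) ≡ ℤ.- + suc r
      k-t≡-[1+r] = trans (cong (λ x → + k ℤ.- x) (ℤ.pos-+ (suc k) r)) (e (+ k) (+ r))
        where e : ∀ k r → k ℤ.- (+ 1 ℤ.+ k ℤ.+ r) ≡ ℤ.- (+ 1 ℤ.+ r)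
              e = solve-∀
      p∤k-t : ¬ (+ p ℤ.∣ + k ℤ.- + (suc k ℕ.+ r))
      p∤k-t p∣k-t = ℕ.<⇒≱ (ℕ.≤-<-trans (ℕ.≤-trans (ℕ.m≤n+m (suc r) k) (ℕ.≤-reflexive (ℕ.+-suc k r))) t<p)
                          (p∣1+n⇒p≤1+n p∣1+r)
        where
        p∣1+r : + p ℤ.∣ + suc r
        p∣1+r = subst (+ p ℤ.∣_) (ℤ.neg-involutive (+ suc r)) (ℤ.∣m⇒∣-m (subst (+ p ℤ.∣_) k-t≡-[1+r] p∣k-t))
    braceTerm-below t t<p k k<K | inj₂ t≤k with ℕ.m≤n⇒∃[o]m+o≡n t≤k
    ...   | x , refl with p ℕ.∣? x
    ...     | yes (ℕ.divides j x≡j*p) = begin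
      braceTerm N (+ t) l p (t ℕ.+ x)                             ≡⟨ braceTerm-on t (t ℕ.+ x) j (cong (t ℕ.+_) x≡j*p) ⟩
      ℤtoℚ (-1ℤ ^ (t ℕ.+ x) ℤ.* + (N C (t ℕ.+ x)) ℤ.* + (j C l))
          ≡⟨ cong (λ c → ℤtoℚ (-1ℤ ^ (t ℕ.+ x) ℤ.* + (N C (t ℕ.+ x)) ℤ.* + c)) (k>n⇒nCk≡0 j<l) ⟩
      ℤtoℚ (-1ℤ ^ (t ℕ.+ x) ℤ.* + (N C (t ℕ.+ x)) ℤ.* + 0)        ≡⟨ cong ℤtoℚ (ℤ.*-zeroʳ (-1ℤ ^ (t ℕ.+ x) ℤ.* + (N C (t ℕ.+ x)))) ⟩
      0ℚ                                                     ∎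
      where
      open ≡-Reasoning
      j<l : j ℕ.< l
      j<l = ℕ.*-cancelʳ-< p j l (subst₂ ℕ._<_ x≡j*p (ℕ.*-comm p l)
              (ℕ.+-cancelʳ-< t x (p ℕ.* l) (subst (ℕ._< p ℕ.* l ℕ.+ t) (ℕ.+-comm t x) k<K)))
    ...     | no p∤x = braceTerm-off t (t ℕ.+ x) (λ p∣k-t → p∤x (ℤ.∣⇒∣ᵤ (subst (+ p ℤ.∣_) (+[m+n]-+m≡+n t x) p∣k-t)))

    braceTerm-off-residue : ∀ t M i → suc i ℕ.< p → braceTerm N (+ t) l p (p ℕ.* M ℕ.+ t ℕ.+ suc i) ≡ 0ℚ
    braceTerm-off-residue t M i 1+i<p = braceTerm-off t _ (λ p∣k-t → ℕ.<⇒≱ 1+i<p (p∣1+n⇒p≤1+n (p∣1+i p∣k-t)))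
      where
      k-t≡pM+1+i : + (p ℕ.* M ℕ.+ t ℕ.+ suc i) ℤ.- + t ≡ + (p ℕ.* M) ℤ.+ + suc i
      k-t≡pM+1+i = begin
        + (p ℕ.* M ℕ.+ t ℕ.+ suc i) ℤ.- + t      ≡⟨ cong (λ n → + n ℤ.- + t) (e (p ℕ.* M) t (suc i)) ⟩
        + (p ℕ.* M ℕ.+ suc i ℕ.+ t) ℤ.- + t      ≡⟨ +[m+n]-+n≡+m (p ℕ.* M ℕ.+ suc i) t ⟩
        + (p ℕ.* M ℕ.+ suc i)                    ≡⟨ ℤ.pos-+ (p ℕ.* M) (suc i) ⟩
        + (p ℕ.* M) ℤ.+ + suc i                  ∎
        where
        open ≡-Reasoning
        e : ∀ a b c → a ℕ.+ b ℕ.+ c ≡ a ℕ.+ c ℕ.+ b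
        e = ℕ-Solver.solve-∀
      p∣1+i : + p ℤ.∣ + (p ℕ.* M ℕ.+ t ℕ.+ suc i) ℤ.- + t → + p ℤ.∣ + suc i
      p∣1+i p∣k-t = ℤ.∣m+n∣m⇒∣n (subst (+ p ℤ.∣_) k-t≡pM+1+i p∣k-t)
                      (divides (+ M) (trans (ℤ.pos-* p M) (ℤ.*-comm (+ p) (+ M))))

    module _ .{{_ : NonZero p}} (t : ℕ) (t<p : t ℕ.< p) where

      private
        K : ℕ
        K = p ℕ.* l ℕ.+ t
        f : ℕ → ℚ
        f = braceTerm N (+ t) l p

      braceTerm-first : f K ≡ ℤtoℚ (-1ℤ ^ K ℤ.* + (N C K))
      braceTerm-first = begin
        f K                                          ≡⟨ braceTerm-on t K l (trans (ℕ.+-comm (p ℕ.* l) t) (cong (t ℕ.+_) (ℕ.*-comm p l))) ⟩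
        ℤtoℚ (-1ℤ ^ K ℤ.* + (N C K) ℤ.* + (l C l))   ≡⟨ cong (λ c → ℤtoℚ (-1ℤ ^ K ℤ.* + (N C K) ℤ.* + c)) (nCn≡1 l) ⟩
        ℤtoℚ (-1ℤ ^ K ℤ.* + (N C K) ℤ.* + 1)         ≡⟨ cong ℤtoℚ (ℤ.*-identityʳ (-1ℤ ^ K ℤ.* + (N C K))) ⟩
        ℤtoℚ (-1ℤ ^ K ℤ.* + (N C K))                 ∎
        where open ≡-Reasoning

      braceTerm-second : f (K ℕ.+ p) ≡ ℤtoℚ (-1ℤ ^ (K ℕ.+ p) ℤ.* + (N C (K ℕ.+ p)) ℤ.* + suc l)
      braceTerm-second = trans (braceTerm-on t (K ℕ.+ p) (suc l) (e p l t))
        (cong (λ c → ℤtoℚ (-1ℤ ^ (K ℕ.+ p) ℤ.* + (N C (K ℕ.+ p)) ℤ.* + c)) [1+l]Cl≡1+l)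
        where
        e : ∀ p l t → p ℕ.* l ℕ.+ t ℕ.+ p ≡ t ℕ.+ suc l ℕ.* p
        e = ℕ-Solver.solve-∀
        [1+l]Cl≡1+l : suc l C l ≡ suc l
        [1+l]Cl≡1+l = trans (nCk≡nC[n∸k] (ℕ.n≤1+n l)) (trans (cong (suc l C_) (ℕ.m+n∸n≡m 1 l)) (nC1≡n (suc l)))

      braceSum-single : ∀ m → m ℕ.< p → N ≡ K ℕ.+ m → sumTo N f ≡ ℤtoℚ (-1ℤ ^ K ℤ.* + (N C K))
      braceSum-single m m<p refl = begin
        sumTo (K ℕ.+ m) f   ≡⟨ sumTo-trailing-zeros K m f (λ i i<m → braceTerm-off-residue t l i (ℕ.≤-<-trans i<m m<p)) ⟩
        sumTo K f           ≡⟨ sumTo-initial-zeros K f (braceTerm-below t t<p) ⟩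
        f K                 ≡⟨ braceTerm-first ⟩
        ℤtoℚ (-1ℤ ^ K ℤ.* + (N C K)) ∎
        where open ≡-Reasoning

      braceSum-pair : ∀ d → d ℕ.< p → N ≡ K ℕ.+ p ℕ.+ d →
        sumTo N f ≡ ℤtoℚ (-1ℤ ^ K ℤ.* + (N C K) ℤ.+ -1ℤ ^ (K ℕ.+ p) ℤ.* + (N C (K ℕ.+ p)) ℤ.* + suc l)
      braceSum-pair d d<p refl = begin
        sumTo (K ℕ.+ p ℕ.+ d) f       ≡⟨ sumTo-trailing-zeros (K ℕ.+ p) d f zeros-after-K+p ⟩
        sumTo (K ℕ.+ p) f             ≡⟨ cong (λ n → sumTo n f) K+p≡1+K+p′ ⟩
        sumTo K′ f + f (suc K′)       ≡⟨ cong (_+ f (suc K′)) (sumTo-trailing-zeros K p′ f zeros-between) ⟩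
        sumTo K f + f (suc K′)        ≡⟨ cong₂ _+_ (sumTo-initial-zeros K f (braceTerm-below t t<p)) (cong f (sym K+p≡1+K+p′)) ⟩
        f K + f (K ℕ.+ p)             ≡⟨ cong₂ _+_ braceTerm-first braceTerm-second ⟩
        ℤtoℚ (-1ℤ ^ K ℤ.* + (N C K)) + ℤtoℚ (-1ℤ ^ (K ℕ.+ p) ℤ.* + (N C (K ℕ.+ p)) ℤ.* + suc l)
                                      ≡⟨ ℤtoℚ-homo-+ (-1ℤ ^ K ℤ.* + (N C K)) _ ⟨
        ℤtoℚ (-1ℤ ^ K ℤ.* + (N C K) ℤ.+ -1ℤ ^ (K ℕ.+ p) ℤ.* + (N C (K ℕ.+ p)) ℤ.* + suc l) ∎
        where
        open ≡-Reasoning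
        p′ K′ : ℕ
        p′ = ℕ.pred p
        K′ = K ℕ.+ p′
        p≡1+p′ : p ≡ suc p′
        p≡1+p′ = sym (ℕ.suc-pred p)
        K+p≡1+K+p′ : K ℕ.+ p ≡ suc K′
        K+p≡1+K+p′ = trans (cong (K ℕ.+_) p≡1+p′) (ℕ.+-suc K p′)
        zeros-between : ∀ i → i ℕ.< p′ → f (K ℕ.+ suc i) ≡ 0ℚ
        zeros-between i i<p′ = braceTerm-off-residue t l i (subst (suc i ℕ.<_) (sym p≡1+p′) (ℕ.s≤s i<p′))
        e : ∀ p l t i → p ℕ.* l ℕ.+ t ℕ.+ p ℕ.+ suc i ≡ p ℕ.* suc l ℕ.+ t ℕ.+ suc i
        e = ℕ-Solver.solve-∀
        zeros-after-K+p : ∀ i → i ℕ.< d → f (K ℕ.+ p ℕ.+ suc i) ≡ 0ℚ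
        zeros-after-K+p i i<d = trans (cong f (e p l t i)) (braceTerm-off-residue t (suc l) i (ℕ.≤-<-trans i<d d<p))

module BraceCongruences where

  open import Data.Nat as ℕ using (ℕ; suc; _!)
  import Data.Nat.Properties as ℕ
  import Data.Nat.Divisibility as ℕ
  open import Data.Nat.Combinatorics using (_C_)
  open import Data.Nat.Primality using (Prime)
  import Data.Nat.Tactic.RingSolver as ℕ-Solver
  open import Data.Integer as ℤ using (ℤ; +_; -1ℤ; 0ℤ; 1ℤ; _^_)
  import Data.Integer.Properties as ℤ
  open import Data.Integer.Divisibility.Signed using (_∣_; divides)
  open import Data.Integer.Tactic.RingSolver using (solve-∀)
  open import Data.Rational using (ℚ; 0ℚ; 1ℚ; _+_; _*_)
  import Data.Rational.Properties as ℚ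
  open import Data.Rational.Solver using (module +-*-Solver)
  open import Relation.Nullary using (¬_)
  open import Relation.Binary.PropositionalEquality
  open import Defs
  open IntegerCongruence
  open FallingFactorial
  open RationalEmbedding
  open BinomialCoefficients
  open BraceEvaluation
  open PuncturedProducts using (prodExcept≡punctured)

  module _ (n′ s v u : ℕ) (p-prime : Prime (suc (suc (s ℕ.+ v) ℕ.+ u))) where

    private
      t p n N K m : ℕ
      t = suc (s ℕ.+ v)
      p = suc (t ℕ.+ u)
      n = suc n′
      N = p ℕ.* n ℕ.+ s
      K = p ℕ.* n′ ℕ.+ t
      m = suc (u ℕ.+ s)
      t<p : t ℕ.< p
      t<p = ℕ.s≤s (ℕ.m≤m+n t u)
      m<p : m ℕ.< p
      m<p = ℕ.s≤s (ℕ.s≤s (ℕ.≤-trans (ℕ.≤-reflexive (ℕ.+-comm u s)) (ℕ.≤-trans (ℕ.m≤m+n (s ℕ.+ u) v) (ℕ.≤-reflexive (e s u v)))))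
        where e : ∀ s u v → s ℕ.+ u ℕ.+ v ≡ s ℕ.+ v ℕ.+ u
              e = ℕ-Solver.solve-∀
      N≡K+m : N ≡ K ℕ.+ m
      N≡K+m = e s v u n′
        where e : ∀ s v u n′ → let p = suc (suc (s ℕ.+ v) ℕ.+ u) in
                    p ℕ.* suc n′ ℕ.+ s ≡ p ℕ.* n′ ℕ.+ suc (s ℕ.+ v) ℕ.+ suc (u ℕ.+ s)
              e = ℕ-Solver.solve-∀

      A B a c E : ℤ
      A = + N ↓ s
      B = (+ (p ℕ.* n) ℤ.- 1ℤ) ↓ u
      a = -1ℤ ^ K ℤ.* + n ℤ.* A ℤ.* B
      c = -1ℤ ^ (n ℕ.+ s) ℤ.* + n ℤ.* + (s !) ℤ.* + (v !)
      E = -1ℤ ^ K ℤ.* + (N C K)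

      N↓m≡A*pn*B : + N ↓ m ≡ A ℤ.* (+ (p ℕ.* n) ℤ.* B)
      N↓m≡A*pn*B = begin
        + N ↓ m                               ≡⟨ cong (+ N ↓_) (trans (cong suc (ℕ.+-comm u s)) (sym (ℕ.+-suc s u))) ⟩
        + N ↓ (s ℕ.+ suc u)                   ≡⟨ ↓-+ (+ N) s (suc u) ⟩
        A ℤ.* (+ N ℤ.- + s) ↓ suc u           ≡⟨ cong (λ x → A ℤ.* x ↓ suc u) (+[m+n]-+n≡+m (p ℕ.* n) s) ⟩
        A ℤ.* (+ (p ℕ.* n) ℤ.* B)             ∎
        where open ≡-Reasoning

      E*m!≡a*p : E ℤ.* + (m !) ≡ a ℤ.* + p
      E*m!≡a*p = begin
        -1ℤ ^ K ℤ.* + (N C K) ℤ.* + (m !)           ≡⟨ ℤ.*-assoc (-1ℤ ^ K) (+ (N C K)) (+ (m !)) ⟩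
        -1ℤ ^ K ℤ.* (+ (N C K) ℤ.* + (m !))         ≡⟨ cong (-1ℤ ^ K ℤ.*_) (nCm*c!≡n↓c K m N≡K+m) ⟩
        -1ℤ ^ K ℤ.* (+ N ↓ m)                       ≡⟨ cong (-1ℤ ^ K ℤ.*_) N↓m≡A*pn*B ⟩
        -1ℤ ^ K ℤ.* (A ℤ.* (+ (p ℕ.* n) ℤ.* B))     ≡⟨ cong (λ x → -1ℤ ^ K ℤ.* (A ℤ.* (x ℤ.* B))) (ℤ.pos-* p n) ⟩
        -1ℤ ^ K ℤ.* (A ℤ.* (+ p ℤ.* + n ℤ.* B))     ≡⟨ e (-1ℤ ^ K) A (+ p) (+ n) B ⟩
        a ℤ.* + p                                   ∎
        where
        open ≡-Reasoning
        e : ∀ σ A P n B → σ ℤ.* (A ℤ.* (P ℤ.* n ℤ.* B)) ≡ σ ℤ.* n ℤ.* A ℤ.* B ℤ.* P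
        e = solve-∀

      brace*m!≡a : brace N (+ t) n′ p * ℤtoℚ (+ (m !)) ≡ ℤtoℚ a
      brace*m!≡a = p*x≡e⇒x*b≡a E a (+ (m !))
        (trans (p*brace≡sum N (+ t) n′ p (braceExp≡1 p n′ s (v ℕ.+ u) (cong suc (e s v u))))
               (braceSum-single N n′ p t t<p m m<p N≡K+m))
        E*m!≡a*p
        where e : ∀ s v u → suc (s ℕ.+ v) ℕ.+ u ≡ s ℕ.+ suc (v ℕ.+ u)
              e = ℕ-Solver.solve-∀

      y W S!V! : ℚ
      y = sgn (n ℕ.+ s) * (ℕtoℚ n // (ℕtoℚ t * ℕtoℚ ((s ℕ.+ v) C s)))
      W = ℕtoℚ t * ℕtoℚ ((s ℕ.+ v) C s)
      S!V! = ℤtoℚ (+ (s !) ℤ.* + (v !))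

      t!≡W*s!v! : ℤtoℚ (+ (t !)) ≡ W * S!V!
      t!≡W*s!v! = begin
        ℤtoℚ (+ (t ℕ.* (s ℕ.+ v) !))                                    ≡⟨ cong (λ x → ℤtoℚ (+ (t ℕ.* x))) ([k+r]Ck*k!*r!≡[k+r]! s v) ⟨
        ℤtoℚ (+ (t ℕ.* (((s ℕ.+ v) C s) ℕ.* (s ! ℕ.* v !))))             ≡⟨ cong ℤtoℚ (e t ((s ℕ.+ v) C s) (s !) (v !)) ⟩
        ℤtoℚ (+ t ℤ.* + ((s ℕ.+ v) C s) ℤ.* (+ (s !) ℤ.* + (v !)))      ≡⟨ ℤtoℚ-homo-* (+ t ℤ.* + ((s ℕ.+ v) C s)) (+ (s !) ℤ.* + (v !)) ⟩
        ℤtoℚ (+ t ℤ.* + ((s ℕ.+ v) C s)) * S!V!                          ≡⟨ cong (_* S!V!) (ℤtoℚ-homo-* (+ t) (+ ((s ℕ.+ v) C s))) ⟩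
        W * S!V!                                                         ∎
        where
        open ≡-Reasoning
        e : ∀ t b x y → + (t ℕ.* (b ℕ.* (x ℕ.* y))) ≡ + t ℤ.* + b ℤ.* (+ x ℤ.* + y)
        e t b x y = trans (cong +_ (sym (ℕ.*-assoc t b (x ℕ.* y))))
                          (trans (ℤ.pos-* (t ℕ.* b) (x ℕ.* y)) (cong₂ ℤ._*_ (ℤ.pos-* t b) (ℤ.pos-* x y)))

      W≢0 : W ≢ 0ℚ
      W≢0 W≡0 = ℕ.≢-nonZero⁻¹ (t !) ⦃ ℕ._!≢0 t ⦄ (ℤ.+-injective (ℤtoℚ-injective (begin
        ℤtoℚ (+ (t !))   ≡⟨ t!≡W*s!v! ⟩
        W * S!V!         ≡⟨ cong (_* S!V!) W≡0 ⟩
        0ℚ * S!V!        ≡⟨ ℚ.*-zeroˡ S!V! ⟩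
        0ℚ               ∎)))
        where open ≡-Reasoning

      y*t!≡c : y * ℤtoℚ (+ (t !)) ≡ ℤtoℚ c
      y*t!≡c = begin
        y * ℤtoℚ (+ (t !))                          ≡⟨ cong (y *_) t!≡W*s!v! ⟩
        sgn (n ℕ.+ s) * (ℕtoℚ n // W) * (W * S!V!)
            ≡⟨ solve 4 (λ σ q W x → σ :* q :* (W :* x) := σ :* (q :* W) :* x) refl (sgn (n ℕ.+ s)) (ℕtoℚ n // W) W S!V! ⟩
        sgn (n ℕ.+ s) * (ℕtoℚ n // W * W) * S!V!    ≡⟨ cong (λ x → sgn (n ℕ.+ s) * x * S!V!) (x//y*y≡x (ℕtoℚ n) W≢0) ⟩
        sgn (n ℕ.+ s) * ℕtoℚ n * S!V!               ≡⟨ cong (λ x → x * ℕtoℚ n * S!V!) (sgn≡ℤtoℚ[-1^] (n ℕ.+ s)) ⟩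
        ℤtoℚ (-1ℤ ^ (n ℕ.+ s)) * ℕtoℚ n * S!V!      ≡⟨ cong (_* S!V!) (ℤtoℚ-homo-* (-1ℤ ^ (n ℕ.+ s)) (+ n)) ⟨
        ℤtoℚ (-1ℤ ^ (n ℕ.+ s) ℤ.* + n) * S!V!       ≡⟨ ℤtoℚ-homo-* (-1ℤ ^ (n ℕ.+ s) ℤ.* + n) (+ (s !) ℤ.* + (v !)) ⟨
        ℤtoℚ (-1ℤ ^ (n ℕ.+ s) ℤ.* + n ℤ.* (+ (s !) ℤ.* + (v !)))
                                                    ≡⟨ cong ℤtoℚ (ℤ.*-assoc (-1ℤ ^ (n ℕ.+ s) ℤ.* + n) (+ (s !)) (+ (v !))) ⟨
        ℤtoℚ c                                      ∎
        where
        open ≡-Reasoning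
        open +-*-Solver using (solve; _:*_; _:=_)

      A≡s! : A ≡ + (s !) [mod p ]
      A≡s! = mod-trans (↓-cong s N≡s) (mod-reflexive (n↓n≡n! s))
        where
        N≡s : + N ≡ + s [mod p ]
        N≡s = subst (_≡ + s [mod p ]) (trans (cong (ℤ._+ + s) (sym (ℤ.pos-* p n))) (sym (ℤ.pos-+ (p ℕ.* n) s)))
                    (multiple+a≡a (+ n) (+ s))

      B≡±u! : B ≡ -1ℤ ^ u ℤ.* + (u !) [mod p ]
      B≡±u! = mod-trans (↓-cong u pn-1≡-1) (mod-reflexive (-1↓c≡±c! u))
        where
        e : ∀ x → x ℤ.- 1ℤ ℤ.- -1ℤ ≡ x
        e = solve-∀
        pn-1≡-1 : + (p ℕ.* n) ℤ.- 1ℤ ≡ -1ℤ [mod p ]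
        pn-1≡-1 = mod-intro (divides (+ n) (trans (e (+ (p ℕ.* n))) (trans (ℤ.pos-* p n) (ℤ.*-comm (+ p) (+ n)))))

      [t+u]!≡±v!m! : + ((t ℕ.+ u) !) ≡ -1ℤ ^ v ℤ.* + (v !) ℤ.* + (m !) [mod p ]
      [t+u]!≡±v!m! = subst (λ k → + (k !) ≡ -1ℤ ^ v ℤ.* + (v !) ℤ.* + (m !) [mod p ]) m+v≡t+u
                           (wilson-split m v (trans (cong (ℕ._+ 1) m+v≡t+u) (ℕ.+-comm (t ℕ.+ u) 1)))
        where
        m+v≡t+u : m ℕ.+ v ≡ t ℕ.+ u
        m+v≡t+u = e u s v
          where e : ∀ u s v → suc (u ℕ.+ s) ℕ.+ v ≡ suc (s ℕ.+ v) ℕ.+ u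
                e = ℕ-Solver.solve-∀

      ±K*±v≡±[n+s] : -1ℤ ^ K ℤ.* -1ℤ ^ v ≡ -1ℤ ^ (n ℕ.+ s) [mod p ]
      ±K*±v≡±[n+s] = begin
        -1ℤ ^ (p ℕ.* n′ ℕ.+ (suc s ℕ.+ v)) ℤ.* -1ℤ ^ v
            ≡⟨ cong (ℤ._* -1ℤ ^ v) (trans (^+ (p ℕ.* n′) (suc s ℕ.+ v)) (cong (-1ℤ ^ (p ℕ.* n′) ℤ.*_) (^+ (suc s) v))) ⟩
        -1ℤ ^ (p ℕ.* n′) ℤ.* (-1ℤ ^ suc s ℤ.* -1ℤ ^ v) ℤ.* -1ℤ ^ v
            ≡⟨ e (-1ℤ ^ (p ℕ.* n′)) (-1ℤ ^ suc s) (-1ℤ ^ v) ⟩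
        -1ℤ ^ (p ℕ.* n′) ℤ.* -1ℤ ^ suc s ℤ.* (-1ℤ ^ v ℤ.* -1ℤ ^ v)
            ≡⟨ cong (-1ℤ ^ (p ℕ.* n′) ℤ.* -1ℤ ^ suc s ℤ.*_) (-1^n*-1^n≡1 v) ⟩
        -1ℤ ^ (p ℕ.* n′) ℤ.* -1ℤ ^ suc s ℤ.* 1ℤ
            ≡⟨ ℤ.*-identityʳ _ ⟩
        -1ℤ ^ (p ℕ.* n′) ℤ.* -1ℤ ^ suc s
            ≈⟨ mod-*-congʳ (-1ℤ ^ suc s) (-1^[p*n]≡-1^n p-prime n′) ⟩
        -1ℤ ^ n′ ℤ.* -1ℤ ^ suc s
            ≡⟨ ^+ n′ (suc s) ⟨
        -1ℤ ^ (n′ ℕ.+ suc s)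
            ≡⟨ cong (-1ℤ ^_) (ℕ.+-suc n′ s) ⟩
        -1ℤ ^ (n ℕ.+ s)
            ∎
        where
        open ≡-mod-Reasoning p
        ^+ : ∀ m n → -1ℤ ^ (m ℕ.+ n) ≡ -1ℤ ^ m ℤ.* -1ℤ ^ n
        ^+ = ℤ.^-distribˡ-+-* -1ℤ
        e : ∀ x y z → x ℤ.* (y ℤ.* z) ℤ.* z ≡ x ℤ.* y ℤ.* (z ℤ.* z)
        e = solve-∀

      a*t!≡c*m! : a ℤ.* + (t !) ≡ c ℤ.* + (m !) [mod p ]
      a*t!≡c*m! = begin
        -1ℤ ^ K ℤ.* + n ℤ.* A ℤ.* B ℤ.* + (t !)
            ≈⟨ mod-*-congʳ (+ (t !)) (mod-*-cong (mod-*-congˡ (-1ℤ ^ K ℤ.* + n) A≡s!) B≡±u!) ⟩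
        -1ℤ ^ K ℤ.* + n ℤ.* + (s !) ℤ.* (-1ℤ ^ u ℤ.* + (u !)) ℤ.* + (t !)
            ≡⟨ ℤ.*-assoc (-1ℤ ^ K ℤ.* + n ℤ.* + (s !)) (-1ℤ ^ u ℤ.* + (u !)) (+ (t !)) ⟩
        -1ℤ ^ K ℤ.* + n ℤ.* + (s !) ℤ.* (-1ℤ ^ u ℤ.* + (u !) ℤ.* + (t !))
            ≈⟨ mod-*-congˡ (-1ℤ ^ K ℤ.* + n ℤ.* + (s !)) (mod-sym (wilson-split t u (ℕ.+-comm (t ℕ.+ u) 1))) ⟩
        -1ℤ ^ K ℤ.* + n ℤ.* + (s !) ℤ.* + ((t ℕ.+ u) !)
            ≈⟨ mod-*-congˡ (-1ℤ ^ K ℤ.* + n ℤ.* + (s !)) [t+u]!≡±v!m! ⟩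
        -1ℤ ^ K ℤ.* + n ℤ.* + (s !) ℤ.* (-1ℤ ^ v ℤ.* + (v !) ℤ.* + (m !))
            ≡⟨ e (-1ℤ ^ K) (-1ℤ ^ v) (+ n) (+ (s !)) (+ (v !)) (+ (m !)) ⟩
        -1ℤ ^ K ℤ.* -1ℤ ^ v ℤ.* (+ n ℤ.* + (s !) ℤ.* + (v !) ℤ.* + (m !))
            ≈⟨ mod-*-congʳ (+ n ℤ.* + (s !) ℤ.* + (v !) ℤ.* + (m !)) ±K*±v≡±[n+s] ⟩
        -1ℤ ^ (n ℕ.+ s) ℤ.* (+ n ℤ.* + (s !) ℤ.* + (v !) ℤ.* + (m !))
            ≡⟨ e′ (-1ℤ ^ (n ℕ.+ s)) (+ n) (+ (s !)) (+ (v !)) (+ (m !)) ⟩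
        c ℤ.* + (m !)
            ∎
        where
        open ≡-mod-Reasoning p
        e : ∀ σ τ n x y z → σ ℤ.* n ℤ.* x ℤ.* (τ ℤ.* y ℤ.* z) ≡ σ ℤ.* τ ℤ.* (n ℤ.* x ℤ.* y ℤ.* z)
        e = solve-∀
        e′ : ∀ σ n x y z → σ ℤ.* (n ℤ.* x ℤ.* y ℤ.* z) ≡ σ ℤ.* n ℤ.* x ℤ.* y ℤ.* z
        e′ = solve-∀

    brace≡±n/[t*[t-1]Cs] : CongQ p (brace N (+ t) n′ p) (sgn (n ℕ.+ s) * (ℕtoℚ n // (ℕtoℚ t * ℕtoℚ ((t ℕ.∸ 1) C s))))
    brace≡±n/[t*[t-1]Cs] = ≡[mod]⇒CongQ p-prime (brace N (+ t) n′ p) y a (+ (m !)) c (+ (t !))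
      brace*m!≡a y*t!≡c (prime∤! p-prime m m<p) (prime∤! p-prime t t<p) a*t!≡c*m!

  [1+sgn[p]]*1≡1+-1^p : ∀ p → (1ℚ + sgn p) * ℤtoℚ 1ℤ ≡ ℤtoℚ (1ℤ ℤ.+ -1ℤ ^ p)
  [1+sgn[p]]*1≡1+-1^p p = trans (ℚ.*-identityʳ (1ℚ + sgn p))
    (sym (trans (ℤtoℚ-homo-+ 1ℤ (-1ℤ ^ p)) (cong (λ x → 1ℚ + x) (sym (sgn≡ℤtoℚ[-1^] p)))))

  1+sgn[p]≡0 : ∀ {p} → Prime p → CongQ p (1ℚ + sgn p) 0ℚ
  1+sgn[p]≡0 {p} p-prime =
    ≡[mod]⇒CongQ p-prime (1ℚ + sgn p) 0ℚ (1ℤ ℤ.+ -1ℤ ^ p) 1ℤ 0ℤ 1ℤ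
      ([1+sgn[p]]*1≡1+-1^p p) (ℚ.*-zeroˡ (ℤtoℚ 1ℤ)) (prime∤1 p-prime) (prime∤1 p-prime)
      (mod-trans (mod-reflexive (ℤ.*-identityʳ (1ℤ ℤ.+ -1ℤ ^ p))) (1+-1^p≡0 p-prime))

  module _ (n′ t d w : ℕ) (p-prime : Prime (suc (t ℕ.+ d ℕ.+ suc w))) where

    private
      p n s K K₂ N j j₂ : ℕ
      p = suc (t ℕ.+ d ℕ.+ suc w)
      n = suc n′
      s = t ℕ.+ d
      K = p ℕ.* n′ ℕ.+ t
      K₂ = K ℕ.+ p
      N = p ℕ.* n ℕ.+ s
      j = d ℕ.+ suc w
      j₂ = t ℕ.+ suc w
      Num Den S : ℤ
      Num = punctured K j t
      Den = punctured d j₂ d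
      S = Den ℤ.+ -1ℤ ^ p ℤ.* Num

      p≡1+j+t : p ≡ suc (j ℕ.+ t)
      p≡1+j+t = cong suc (e t d w)
        where e : ∀ t d w → t ℕ.+ d ℕ.+ suc w ≡ d ℕ.+ suc w ℕ.+ t
              e = ℕ-Solver.solve-∀

      p≡1+j₂+d : p ≡ suc (j₂ ℕ.+ d)
      p≡1+j₂+d = cong suc (e t d w)
        where e : ∀ t d w → t ℕ.+ d ℕ.+ suc w ≡ t ℕ.+ suc w ℕ.+ d
              e = ℕ-Solver.solve-∀

      d<p : d ℕ.< p
      d<p = ℕ.s≤s (ℕ.≤-trans (ℕ.m≤n+m d t) (ℕ.m≤m+n (t ℕ.+ d) (suc w)))

    σ≡1+±Num/Den : σ p n s t ≡ 1ℚ + sgn p * (ℤtoℚ Num // ℤtoℚ Den)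
    σ≡1+±Num/Den = cong₂ (λ x y → 1ℚ + sgn p * (x // y)) numerator denominator
      where
      numerator : prodExcept p (p ℕ.∸ t) (λ i → ℕtoℚ (K ℕ.+ i)) ≡ ℤtoℚ Num
      numerator = trans (cong₂ (λ P J → prodExcept P J (λ i → ℕtoℚ (K ℕ.+ i))) p≡1+j+t p-t≡1+j)
                        (prodExcept≡punctured K j t)
        where
        p-t≡1+j : p ℕ.∸ t ≡ suc j
        p-t≡1+j = trans (cong (ℕ._∸ t) (trans p≡1+j+t (sym (trans (ℕ.+-suc t j) (cong suc (ℕ.+-comm t j))))))
                        (ℕ.m+n∸m≡n t (suc j))
      denominator : prodExcept p (p ℕ.∸ (s ℕ.∸ t)) (λ i → ℕtoℚ (s ℕ.∸ t ℕ.+ i)) ≡ ℤtoℚ Den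
      denominator rewrite ℕ.m+n∸m≡n t d =
        trans (cong₂ (λ P J → prodExcept P J (λ i → ℕtoℚ (d ℕ.+ i))) p≡1+j₂+d p-d≡1+j₂)
              (prodExcept≡punctured d j₂ d)
        where
        p-d≡1+j₂ : p ℕ.∸ d ≡ suc j₂
        p-d≡1+j₂ = trans (cong (ℕ._∸ d) (trans p≡1+j₂+d (sym (trans (ℕ.+-suc d j₂) (cong suc (ℕ.+-comm d j₂))))))
                         (ℕ.m+n∸m≡n d (suc j₂))

    private
      Num≡[p-1]! : Num ≡ + ((t ℕ.+ j) !) [mod p ]
      Num≡[p-1]! = punctured≡[p-1]! K j t p≡1+j+t (ℕ.divides n (e t d w n′))
        where e : ∀ t d w n′ → (suc (t ℕ.+ d ℕ.+ suc w)) ℕ.* n′ ℕ.+ t ℕ.+ suc (d ℕ.+ suc w) ≡ suc n′ ℕ.* suc (t ℕ.+ d ℕ.+ suc w)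
              e = ℕ-Solver.solve-∀

      Den≡[p-1]! : Den ≡ + ((t ℕ.+ j) !) [mod p ]
      Den≡[p-1]! = subst (λ k → Den ≡ + (k !) [mod p ]) (e t d w)
                         (punctured≡[p-1]! d j₂ d p≡1+j₂+d (ℕ.divides 1 (e′ t d w)))
        where
        e : ∀ t d w → d ℕ.+ (t ℕ.+ suc w) ≡ t ℕ.+ (d ℕ.+ suc w)
        e = ℕ-Solver.solve-∀
        e′ : ∀ t d w → d ℕ.+ suc (t ℕ.+ suc w) ≡ 1 ℕ.* suc (t ℕ.+ d ℕ.+ suc w)
        e′ = ℕ-Solver.solve-∀

      p∤Den : ¬ (+ p ∣ Den)
      p∤Den = ∤-resp-≡[mod] p-prime (prime∤! p-prime (t ℕ.+ j) t+j<p) (mod-sym Den≡[p-1]!)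
        where
        t+j<p : t ℕ.+ j ℕ.< p
        t+j<p = ℕ.s≤s (ℕ.≤-reflexive (sym (ℕ.+-assoc t d (suc w))))

      S≡[1+±1]*Den : S ≡ (1ℤ ℤ.+ -1ℤ ^ p) ℤ.* Den [mod p ]
      S≡[1+±1]*Den = begin
        Den ℤ.+ -1ℤ ^ p ℤ.* Num    ≈⟨ mod-+-cong (mod-refl {a = Den}) (mod-*-congˡ (-1ℤ ^ p) (mod-trans Num≡[p-1]! (mod-sym Den≡[p-1]!))) ⟩
        Den ℤ.+ -1ℤ ^ p ℤ.* Den    ≡⟨ e Den (-1ℤ ^ p) ⟩
        (1ℤ ℤ.+ -1ℤ ^ p) ℤ.* Den   ∎
        where
        open ≡-mod-Reasoning p
        e : ∀ D σ → D ℤ.+ σ ℤ.* D ≡ (1ℤ ℤ.+ σ) ℤ.* D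
        e = solve-∀

      S≡0 : S ≡ 0ℤ [mod p ]
      S≡0 = mod-trans S≡[1+±1]*Den (mod-*-congʳ Den (1+-1^p≡0 p-prime))

      Z : ℤ
      Z = _∣_.quotient (divides-difference S≡0)

      S≡Z*p : S ≡ Z ℤ.* + p
      S≡Z*p = trans (sym (ℤ.+-identityʳ S)) (_∣_.equality (divides-difference S≡0))

      σ*Den≡S : σ p n s t * ℤtoℚ Den ≡ ℤtoℚ S
      σ*Den≡S = begin
        σ p n s t * D                          ≡⟨ cong (_* D) σ≡1+±Num/Den ⟩
        (1ℚ + sgn p * (ℤtoℚ Num // D)) * D     ≡⟨ solve 3 (λ σ q D → (con 1ℚ :+ σ :* q) :* D := D :+ σ :* (q :* D)) refl (sgn p) (ℤtoℚ Num // D) D ⟩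
        D + sgn p * (ℤtoℚ Num // D * D)        ≡⟨ cong (λ x → D + sgn p * x) (x//y*y≡x (ℤtoℚ Num) (ℤtoℚ-≢0 (∤⇒≢0 p∤Den))) ⟩
        D + sgn p * ℤtoℚ Num                   ≡⟨ cong (λ x → D + x * ℤtoℚ Num) (sgn≡ℤtoℚ[-1^] p) ⟩
        D + ℤtoℚ (-1ℤ ^ p) * ℤtoℚ Num          ≡⟨ cong (λ x → D + x) (ℤtoℚ-homo-* (-1ℤ ^ p) Num) ⟨
        D + ℤtoℚ (-1ℤ ^ p ℤ.* Num)             ≡⟨ ℤtoℚ-homo-+ Den (-1ℤ ^ p ℤ.* Num) ⟨
        ℤtoℚ S                                 ∎
        where
        open ≡-Reasoning
        open +-*-Solver using (solve; _:+_; _:*_; _:=_; con)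
        D : ℚ
        D = ℤtoℚ Den

    σ≡1+sgn[p] : CongQ p (σ p n s t) (1ℚ + sgn p)
    σ≡1+sgn[p] = ≡[mod]⇒CongQ p-prime (σ p n s t) (1ℚ + sgn p) S Den (1ℤ ℤ.+ -1ℤ ^ p) 1ℤ
      σ*Den≡S ([1+sgn[p]]*1≡1+-1^p p) p∤Den (prime∤1 p-prime)
      (mod-trans (mod-reflexive (ℤ.*-identityʳ S)) S≡[1+±1]*Den)

    private
      C₁ C₂ : ℕ
      E a : ℤ
      C₁ = N C K
      C₂ = N C K₂
      E = -1ℤ ^ K ℤ.* + C₁ ℤ.+ -1ℤ ^ K₂ ℤ.* + C₂ ℤ.* + n
      a = -1ℤ ^ K₂ ℤ.* + n ℤ.* + C₂ ℤ.* Z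

      N≡K+[d+p] : N ≡ K ℕ.+ (d ℕ.+ p)
      N≡K+[d+p] = e t d w n′
        where e : ∀ t d w n′ → let p = suc (t ℕ.+ d ℕ.+ suc w) in p ℕ.* suc n′ ℕ.+ (t ℕ.+ d) ≡ p ℕ.* n′ ℕ.+ t ℕ.+ (d ℕ.+ p)
              e = ℕ-Solver.solve-∀

      N≡K₂+d : N ≡ K₂ ℕ.+ d
      N≡K₂+d = e t d w n′
        where e : ∀ t d w n′ → let p = suc (t ℕ.+ d ℕ.+ suc w) in p ℕ.* suc n′ ℕ.+ (t ℕ.+ d) ≡ p ℕ.* n′ ℕ.+ t ℕ.+ p ℕ.+ d
              e = ℕ-Solver.solve-∀

      K₂↓p≡Num*pn : + K₂ ↓ p ≡ Num ℤ.* + (p ℕ.* n)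
      K₂↓p≡Num*pn = begin
        + (K ℕ.+ p) ↓ p                                   ≡⟨ cong (λ q → + (K ℕ.+ q) ↓ q) p≡1+j+t ⟩
        + (K ℕ.+ suc (j ℕ.+ t)) ↓ suc (j ℕ.+ t)           ≡⟨ block≡punctured*omitted K j t ⟩
        Num ℤ.* + (K ℕ.+ suc j)                           ≡⟨ cong (λ x → Num ℤ.* + x) (e t d w n′) ⟩
        Num ℤ.* + (p ℕ.* n)                               ∎
        where
        open ≡-Reasoning
        e : ∀ t d w n′ → let p = suc (t ℕ.+ d ℕ.+ suc w) in p ℕ.* n′ ℕ.+ t ℕ.+ suc (d ℕ.+ suc w) ≡ p ℕ.* suc n′
        e = ℕ-Solver.solve-∀

      [d+p]↓p≡Den*p : + (d ℕ.+ p) ↓ p ≡ Den ℤ.* + p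
      [d+p]↓p≡Den*p = begin
        + (d ℕ.+ p) ↓ p                                   ≡⟨ cong (λ q → + (d ℕ.+ q) ↓ q) p≡1+j₂+d ⟩
        + (d ℕ.+ suc (j₂ ℕ.+ d)) ↓ suc (j₂ ℕ.+ d)         ≡⟨ block≡punctured*omitted d j₂ d ⟩
        Den ℤ.* + (d ℕ.+ suc j₂)                          ≡⟨ cong (λ x → Den ℤ.* + x) (e t d w) ⟩
        Den ℤ.* + p                                       ∎
        where
        open ≡-Reasoning
        e : ∀ t d w → d ℕ.+ suc (t ℕ.+ suc w) ≡ suc (t ℕ.+ d ℕ.+ suc w)
        e = ℕ-Solver.solve-∀

      -- This is what makes the two surviving terms of the bracket combine into a multiple of σ.
      C₁*Den≡C₂*Num*n : + C₁ ℤ.* Den ≡ + C₂ ℤ.* Num ℤ.* + n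
      C₁*Den≡C₂*Num*n = ℤ.*-cancelʳ-≡ _ _ (+ p) (ℤ.*-cancelʳ-≡ _ _ (+ (d !)) ⦃ ℕ._!≢0 d ⦄ (begin
        + C₁ ℤ.* Den ℤ.* + p ℤ.* + (d !)                  ≡⟨ e₁ (+ C₁) Den (+ p) (+ (d !)) ⟩
        + C₁ ℤ.* (Den ℤ.* + p ℤ.* + (d !))                ≡⟨ cong (λ x → + C₁ ℤ.* (x ℤ.* + (d !))) [d+p]↓p≡Den*p ⟨
        + C₁ ℤ.* (+ (d ℕ.+ p) ↓ p ℤ.* + (d !))            ≡⟨ cong (+ C₁ ℤ.*_) ([m+c]!≡[m+c]↓c*m! d p) ⟨
        + C₁ ℤ.* + ((d ℕ.+ p) !)                          ≡⟨ nCm*c!≡n↓c K (d ℕ.+ p) N≡K+[d+p] ⟩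
        + N ↓ (d ℕ.+ p)                                   ≡⟨ ↓-+ (+ N) d p ⟩
        + N ↓ d ℤ.* (+ N ℤ.- + d) ↓ p
            ≡⟨ cong (λ x → + N ↓ d ℤ.* x ↓ p) (trans (cong (λ k → + k ℤ.- + d) N≡K₂+d) (+[m+n]-+n≡+m K₂ d)) ⟩
        + N ↓ d ℤ.* + K₂ ↓ p                              ≡⟨ cong (+ N ↓ d ℤ.*_) K₂↓p≡Num*pn ⟩
        + N ↓ d ℤ.* (Num ℤ.* + (p ℕ.* n))                 ≡⟨ cong (ℤ._* (Num ℤ.* + (p ℕ.* n))) (nCm*c!≡n↓c K₂ d N≡K₂+d) ⟨
        + C₂ ℤ.* + (d !) ℤ.* (Num ℤ.* + (p ℕ.* n))        ≡⟨ cong (λ x → + C₂ ℤ.* + (d !) ℤ.* (Num ℤ.* x)) (ℤ.pos-* p n) ⟩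
        + C₂ ℤ.* + (d !) ℤ.* (Num ℤ.* (+ p ℤ.* + n))      ≡⟨ e₂ (+ C₂) (+ (d !)) Num (+ p) (+ n) ⟩
        + C₂ ℤ.* Num ℤ.* + n ℤ.* + p ℤ.* + (d !)          ∎))
        where
        open ≡-Reasoning
        e₁ : ∀ C D P F → C ℤ.* D ℤ.* P ℤ.* F ≡ C ℤ.* (D ℤ.* P ℤ.* F)
        e₁ = solve-∀
        e₂ : ∀ C F U P n → C ℤ.* F ℤ.* (U ℤ.* (P ℤ.* n)) ≡ C ℤ.* U ℤ.* n ℤ.* P ℤ.* F
        e₂ = solve-∀

      ±K≡±K₂*±p : -1ℤ ^ K ≡ -1ℤ ^ K₂ ℤ.* -1ℤ ^ p
      ±K≡±K₂*±p = begin
        -1ℤ ^ K                                   ≡⟨ ℤ.*-identityʳ (-1ℤ ^ K) ⟨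
        -1ℤ ^ K ℤ.* 1ℤ                            ≡⟨ cong (-1ℤ ^ K ℤ.*_) (-1^n*-1^n≡1 p) ⟨
        -1ℤ ^ K ℤ.* (-1ℤ ^ p ℤ.* -1ℤ ^ p)         ≡⟨ ℤ.*-assoc (-1ℤ ^ K) (-1ℤ ^ p) (-1ℤ ^ p) ⟨
        -1ℤ ^ K ℤ.* -1ℤ ^ p ℤ.* -1ℤ ^ p           ≡⟨ cong (ℤ._* -1ℤ ^ p) (ℤ.^-distribˡ-+-* -1ℤ K p) ⟨
        -1ℤ ^ K₂ ℤ.* -1ℤ ^ p                      ∎
        where open ≡-Reasoning

      E*Den≡a*p : E ℤ.* Den ≡ a ℤ.* + p
      E*Den≡a*p = begin
        E ℤ.* Den                                                            ≡⟨ e₁ (-1ℤ ^ K) (+ C₁) (-1ℤ ^ K₂) (+ C₂) (+ n) Den ⟩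
        -1ℤ ^ K ℤ.* (+ C₁ ℤ.* Den) ℤ.+ -1ℤ ^ K₂ ℤ.* + C₂ ℤ.* + n ℤ.* Den
            ≡⟨ cong₂ (λ x y → x ℤ.* y ℤ.+ -1ℤ ^ K₂ ℤ.* + C₂ ℤ.* + n ℤ.* Den) ±K≡±K₂*±p C₁*Den≡C₂*Num*n ⟩
        -1ℤ ^ K₂ ℤ.* -1ℤ ^ p ℤ.* (+ C₂ ℤ.* Num ℤ.* + n) ℤ.+ -1ℤ ^ K₂ ℤ.* + C₂ ℤ.* + n ℤ.* Den
                                                                             ≡⟨ e₂ (-1ℤ ^ K₂) (-1ℤ ^ p) (+ C₂) Num (+ n) Den ⟩
        -1ℤ ^ K₂ ℤ.* + n ℤ.* + C₂ ℤ.* S                                      ≡⟨ cong (-1ℤ ^ K₂ ℤ.* + n ℤ.* + C₂ ℤ.*_) S≡Z*p ⟩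
        -1ℤ ^ K₂ ℤ.* + n ℤ.* + C₂ ℤ.* (Z ℤ.* + p)                            ≡⟨ ℤ.*-assoc (-1ℤ ^ K₂ ℤ.* + n ℤ.* + C₂) Z (+ p) ⟨
        a ℤ.* + p                                                            ∎
        where
        open ≡-Reasoning
        e₁ : ∀ σ C τ C′ n D → (σ ℤ.* C ℤ.+ τ ℤ.* C′ ℤ.* n) ℤ.* D ≡ σ ℤ.* (C ℤ.* D) ℤ.+ τ ℤ.* C′ ℤ.* n ℤ.* D
        e₁ = solve-∀
        e₂ : ∀ τ π C U n D → τ ℤ.* π ℤ.* (C ℤ.* U ℤ.* n) ℤ.+ τ ℤ.* C ℤ.* n ℤ.* D ≡ τ ℤ.* n ℤ.* C ℤ.* (D ℤ.+ π ℤ.* U)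
        e₂ = solve-∀

      brace*Den≡a : brace N (+ t) n′ p * ℤtoℚ Den ≡ ℤtoℚ a
      brace*Den≡a = p*x≡e⇒x*b≡a E a Den
        (trans (p*brace≡sum N (+ t) n′ p (braceExp≡1 p n′ s w refl))
               (braceSum-pair N n′ p t t<p d d<p (trans N≡K₂+d refl)))
        E*Den≡a*p
        where
        t<p : t ℕ.< p
        t<p = ℕ.s≤s (ℕ.≤-trans (ℕ.m≤m+n t d) (ℕ.m≤m+n (t ℕ.+ d) (suc w)))

      σ/p*Den≡Z : (σ p n s t // ℕtoℚ p) * ℤtoℚ Den ≡ ℤtoℚ Z
      σ/p*Den≡Z = *-cancelʳ-≡ (σ/p * D) (ℤtoℚ Z) (ℕtoℚ-≢0 p) (begin
        σ/p * D * P                ≡⟨ solve 3 (λ x D P → x :* D :* P := x :* P :* D) refl σ/p D P ⟩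
        σ/p * P * D                ≡⟨ cong (_* D) (x//y*y≡x (σ p n s t) (ℕtoℚ-≢0 p)) ⟩
        σ p n s t * D              ≡⟨ σ*Den≡S ⟩
        ℤtoℚ S                     ≡⟨ cong ℤtoℚ S≡Z*p ⟩
        ℤtoℚ (Z ℤ.* + p)           ≡⟨ ℤtoℚ-homo-* Z (+ p) ⟩
        ℤtoℚ Z * P                 ∎)
        where
        open ≡-Reasoning
        open +-*-Solver using (solve; _:*_; _:=_)
        P D σ/p : ℚ
        P = ℕtoℚ p
        D = ℤtoℚ Den
        σ/p = σ p n s t // P

      c : ℤ
      c = -1ℤ ^ (n ℕ.+ t) ℤ.* + n ℤ.* + (s C t) ℤ.* Z

      y*Den≡c : sgn (n ℕ.+ t) * ℕtoℚ n * ℕtoℚ (s C t) * (σ p n s t // ℕtoℚ p) * ℤtoℚ Den ≡ ℤtoℚ c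
      y*Den≡c = begin
        sgn (n ℕ.+ t) * ℕtoℚ n * ℕtoℚ (s C t) * (σ p n s t // ℕtoℚ p) * ℤtoℚ Den
            ≡⟨ ℚ.*-assoc (sgn (n ℕ.+ t) * ℕtoℚ n * ℕtoℚ (s C t)) (σ p n s t // ℕtoℚ p) (ℤtoℚ Den) ⟩
        sgn (n ℕ.+ t) * ℕtoℚ n * ℕtoℚ (s C t) * ((σ p n s t // ℕtoℚ p) * ℤtoℚ Den)
            ≡⟨ cong₂ (λ x y → x * ℕtoℚ n * ℕtoℚ (s C t) * y) (sgn≡ℤtoℚ[-1^] (n ℕ.+ t)) σ/p*Den≡Z ⟩
        ℤtoℚ (-1ℤ ^ (n ℕ.+ t)) * ℤtoℚ (+ n) * ℤtoℚ (+ (s C t)) * ℤtoℚ Z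
            ≡⟨ cong (λ x → x * ℤtoℚ (+ (s C t)) * ℤtoℚ Z) (ℤtoℚ-homo-* (-1ℤ ^ (n ℕ.+ t)) (+ n)) ⟨
        ℤtoℚ (-1ℤ ^ (n ℕ.+ t) ℤ.* + n) * ℤtoℚ (+ (s C t)) * ℤtoℚ Z
            ≡⟨ cong (_* ℤtoℚ Z) (ℤtoℚ-homo-* (-1ℤ ^ (n ℕ.+ t) ℤ.* + n) (+ (s C t))) ⟨
        ℤtoℚ (-1ℤ ^ (n ℕ.+ t) ℤ.* + n ℤ.* + (s C t)) * ℤtoℚ Z
            ≡⟨ ℤtoℚ-homo-* (-1ℤ ^ (n ℕ.+ t) ℤ.* + n ℤ.* + (s C t)) Z ⟨
        ℤtoℚ c
            ∎
        where open ≡-Reasoning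

      K₂≡pn+t : K₂ ≡ p ℕ.* n ℕ.+ t
      K₂≡pn+t = e t d w n′
        where e : ∀ t d w n′ → let p = suc (t ℕ.+ d ℕ.+ suc w) in p ℕ.* n′ ℕ.+ t ℕ.+ p ≡ p ℕ.* suc n′ ℕ.+ t
              e = ℕ-Solver.solve-∀

      ±K₂≡±[n+t] : -1ℤ ^ K₂ ≡ -1ℤ ^ (n ℕ.+ t) [mod p ]
      ±K₂≡±[n+t] = begin
        -1ℤ ^ K₂                          ≡⟨ trans (cong (-1ℤ ^_) K₂≡pn+t) (ℤ.^-distribˡ-+-* -1ℤ (p ℕ.* n) t) ⟩
        -1ℤ ^ (p ℕ.* n) ℤ.* -1ℤ ^ t       ≈⟨ mod-*-congʳ (-1ℤ ^ t) (-1^[p*n]≡-1^n p-prime n) ⟩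
        -1ℤ ^ n ℤ.* -1ℤ ^ t               ≡⟨ ℤ.^-distribˡ-+-* -1ℤ n t ⟨
        -1ℤ ^ (n ℕ.+ t)                   ∎
        where open ≡-mod-Reasoning p

      C₂≡sCt : + C₂ ≡ + (s C t) [mod p ]
      C₂≡sCt = subst₂ (λ x y → + (x C y) ≡ + (s C t) [mod p ]) (ℕ.+-assoc (p ℕ.* n) t d) (sym K₂≡pn+t)
                      ([pM+t+d]C[pM+t]≡[t+d]Ct p-prime n t d d<p)

    brace≡±n*sCt*σ/p : CongQ p (brace N (+ t) n′ p) (sgn (n ℕ.+ t) * ℕtoℚ n * ℕtoℚ (s C t) * (σ p n s t // ℕtoℚ p))
    brace≡±n*sCt*σ/p = ≡[mod]⇒CongQ p-prime (brace N (+ t) n′ p) (sgn (n ℕ.+ t) * ℕtoℚ n * ℕtoℚ (s C t) * (σ p n s t // ℕtoℚ p))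
      a Den c Den brace*Den≡a y*Den≡c p∤Den p∤Den
      (mod-*-congʳ Den (mod-*-congʳ Z (mod-*-cong (mod-*-congʳ (+ n) ±K₂≡±[n+t]) C₂≡sCt)))

open import Defs
open import Data.Nat using (ℕ; _+_; _*_; _∸_; _<_; _≤_)
open import Data.Nat.Primality using (Prime)
open import Data.Nat.Combinatorics using (_C_)
open import Data.Integer using (+_)
open import Data.Rational using (0ℚ; 1ℚ) renaming (_+_ to _+ℚ_; _*_ to _*ℚ_)
open import Data.Product using (_×_)
open import Relation.Binary.PropositionalEquality using (_≢_)

open import Data.Nat using (suc; s≤s; z≤n)
open import Data.Nat.Properties using (m≤n⇒∃[o]m+o≡n; ≤∧≢⇒<; +-suc)
open import Data.Product using (_,_)
open import Relation.Binary.PropositionalEquality using (refl; sym; trans; cong)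
open BraceCongruences

lemma3p3 : (p n s t : ℕ) → Prime p → 1 ≤ n → s < p → t < p → s ≢ p ∸ 1 →
    (s < t →
      CongQ p (brace (p * n + s) (+ t) (n ∸ 1) p)
              (sgn (n + s) *ℚ (ℕtoℚ n // (ℕtoℚ t *ℚ ℕtoℚ ((t ∸ 1) C s)))))
    ×
    (t ≤ s →
      CongQ p (σ p n s t) (1ℚ +ℚ sgn p)
      × CongQ p (1ℚ +ℚ sgn p) 0ℚ
      × CongQ p (brace (p * n + s) (+ t) (n ∸ 1) p)
                (sgn (n + t) *ℚ ℕtoℚ n *ℚ ℕtoℚ (s C t) *ℚ (σ p n s t // ℕtoℚ p)))
lemma3p3 p (suc n′) s t p-prime (s≤s z≤n) s<p t<p s≢p-1 = when-s<t , when-t≤s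
  where
  n : ℕ
  n = suc n′

  when-s<t : s < t →
    CongQ p (brace (p * n + s) (+ t) n′ p) (sgn (n + s) *ℚ (ℕtoℚ n // (ℕtoℚ t *ℚ ℕtoℚ ((t ∸ 1) C s))))
  when-s<t s<t with m≤n⇒∃[o]m+o≡n s<t | m≤n⇒∃[o]m+o≡n t<p
  ... | v , refl | u , refl = brace≡±n/[t*[t-1]Cs] n′ s v u p-prime

  1+s<p : suc s < p
  1+s<p = ≤∧≢⇒< s<p (λ 1+s≡p → s≢p-1 (cong (_∸ 1) 1+s≡p))

  when-t≤s : t ≤ s →
    CongQ p (σ p n s t) (1ℚ +ℚ sgn p)
    × CongQ p (1ℚ +ℚ sgn p) 0ℚ
    × CongQ p (brace (p * n + s) (+ t) n′ p) (sgn (n + t) *ℚ ℕtoℚ n *ℚ ℕtoℚ (s C t) *ℚ (σ p n s t // ℕtoℚ p))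
  when-t≤s t≤s with m≤n⇒∃[o]m+o≡n t≤s | m≤n⇒∃[o]m+o≡n 1+s<p
  ... | d , refl | w , 2+s+w≡p with trans (sym 2+s+w≡p) (cong suc (sym (+-suc (t + d) w)))
  ...   | refl = σ≡1+sgn[p] n′ t d w p-prime , 1+sgn[p]≡0 p-prime , brace≡±n*sCt*σ/p n′ t d w p-prime
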